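{- Let $k\ge 2$ be an integer and $S=\{6k+1,12k-4,12k\}$. Then the numerical semigroup $\langle S\rangle$ is a $3$-permutation numerical semigroup.
   Context: A numerical semigroup is a submonoid $G$ of $(\mathbb{N},+,0)$ with $\mathbb{N}\setminus G$ finite; $\langle S\rangle$ is the submonoid generated by $S$. Write the elements of $G$ as $0=g_0<g_1<g_2<\cdots$. For $n\ge 1$, $G$ is an $n$-permutation numerical semigroup if $G=\langle g_1,\dots,g_n\rangle$ and for every integer $k\ge 0$ the tuple $(g_{kn+1}\bmod n,\dots,g_{kn+n}\bmod n)$ contains exactly one representative of each residue class of $\mathbb{Z}/n\mathbb{Z}$. -}

module Defs where

open import Data.Nat using (ℕ; zero; suc; _+_; _*_; _≤_; _<_; NonZero)
open import Data.Nat.DivMod using (_%_)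
open import Data.Fin using (Fin; toℕ)
open import Data.Product using (Σ; ∃; ∃-syntax; _×_; ∃!)
open import Relation.Binary.PropositionalEquality using (_≡_)

Subsetℕ : Set₁
Subsetℕ = ℕ → Set

data ⟨_⟩ {m : ℕ} (a : Fin m → ℕ) : ℕ → Set where
  gen-zero : ⟨ a ⟩ 0
  gen-add  : ∀ {x} → ⟨ a ⟩ x → (i : Fin m) → ⟨ a ⟩ (x + a i)

_≐_ : Subsetℕ → Subsetℕ → Set
G ≐ H = ∀ x → (G x → H x) × (H x → G x)

record IsNumericalSemigroup (G : Subsetℕ) : Set where
  field
    has-zero  : G 0
    closed-+  : ∀ {x y} → G x → G y → G (x + y)
    cofinite  : ∃[ N ] (∀ x → N ≤ x → G x)

record IsIncreasingEnumeration (G : Subsetℕ) (g : ℕ → ℕ) : Set where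
  field
    strictly-increasing : ∀ i → g i < g (suc i)
    elements            : ∀ i → G (g i)
    exhaustive          : ∀ x → G x → ∃[ i ] g i ≡ x

-- n-permutation numerical semigroup (n ≥ 1, encoded as NonZero n).
-- g is the increasing enumeration of G; g (suc (toℕ j)) for j : Fin n is g_{j+1}.
record IsPermutationNS (n : ℕ) .{{_ : NonZero n}} (G : Subsetℕ) : Set where
  field
    numerical : IsNumericalSemigroup G
    g         : ℕ → ℕ
    enum      : IsIncreasingEnumeration G g
    generated : G ≐ ⟨ (λ (j : Fin n) → g (suc (toℕ j))) ⟩
    residues  : ∀ (k : ℕ) (r : Fin n) →
                ∃! _≡_ (λ (j : Fin n) → g (k * n + suc (toℕ j)) % n ≡ toℕ r)

-- Scan ℕ upwards with a four-state automaton that records which residues mod 3 occur among the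
-- elements of the current, incomplete triple g_{3j+1}, g_{3j+2}, g_{3j+3}; the theorem says that it
-- never sees a residue twice. Membership is explicit (generators a < b < c, k = n + 2): with D = b/2,
-- x ∈ G iff x = 2m or x = a + 2m with m ∈ H = ⟨D, D + 2, D + 3⟩ (count the uses of a), and t + M·D ∈ H
-- iff t ≤ 3M and t ≠ 1, except that t = 1 is reached by a carry once M ≥ 5 + 2n. Reading positions
-- in pairs 2y, 2y + 1, each block of D consecutive y spells a word made of a bounded number of runs
-- of one letter, of lengths linear in n and in the block index. A run acts on the automaton with
-- period 3 (three letters advance the residue by 6), so every block is settled by evaluating a fixed
-- word, and every block hands the next one a state of the same shape. From block 2n + 3 on, every
-- number lies in G.

module Submission where

import Algebra.Properties.CommutativeSemigroup
open import Data.Bool using (Bool; true; false; if_then_else_; _∧_)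
open import Data.Bool.Properties using (∧-conicalˡ; ∧-conicalʳ; ¬-not)
open import Data.Empty using (⊥; ⊥-elim)
open import Data.Fin using (Fin; toℕ; punchOut; _≟_)
open import Data.Fin.Patterns using (0F; 1F; 2F)
open import Data.Fin.Properties using (toℕ-injective; any?; pigeonhole; punchOut-injective; <⇒≢)
open import Data.List using (List; []; _∷_)
import Data.List as List
open import Data.Nat using (ℕ; zero; suc; _+_; _*_; _∸_; _≤_; _<_; z≤n; s≤s; _≤?_; _<?_)
  renaming (_≟_ to _≟ℕ_)
open import Data.Nat.DivMod
  using (_%_; _/_; [m+n]%n≡m%n; [m+kn]%n≡m%n; m≡m%n+[m/n]*n; m<n⇒m%n≡m; m*n%n≡0; m<n⇒m/n≡0; m*n/n≡m;
         +-distrib-/; m%n≤m; m%n<n; /-monoˡ-≤)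
open import Data.Nat.GeneralisedArithmetic using (fold; fold-+)
open import Data.Nat.Properties
  using (+-comm; +-assoc; +-suc; +-identityʳ; *-suc; *-distribʳ-+; +-commutativeSemigroup; ≤-refl;
         ≤-reflexive; ≤-trans; ≤-pred; n≤1+n; n<1+n; m≤m+n; m≤n+m; m≤n⇒m≤1+n; <-trans; <⇒≤; <⇒≱;
         ≤⇒≯; ≰⇒>; ≮⇒≥; ≤∧≢⇒<; <-cmp; m≤n⇒m<n∨m≡n; m≤n⇒∃[o]m+o≡n; +-mono-≤; +-monoˡ-≤; +-monoʳ-≤;
         +-mono-<; +-monoˡ-<; +-monoʳ-<; *-monoˡ-≤; *-monoʳ-≤; +-cancelˡ-≤; ∸-monoˡ-≤; m+n∸m≡n;
         m+n∸n≡m; m+[n∸m]≡n; module ≤-Reasoning)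
open import Data.Nat.Tactic.RingSolver using (solve; solve-∀)
open import Data.Product using (∃; ∃₂; ∃!; _×_; _,_; proj₁; proj₂)
open import Data.Product.Properties using (≡-dec)
open import Data.Sum using (_⊎_; inj₁; inj₂)
import Data.Sum as Sum
open import Data.Unit using (⊤; tt)
open import Data.Vec using (lookup; _∷_; [])
open import Defs
open import Function.Base using (_∘_)
open import Function.Definitions using (Injective)
open import Relation.Binary using (tri<; tri≈; tri>)
open import Relation.Binary.Definitions using (DecidableEquality)
open import Relation.Binary.PropositionalEquality
open import Relation.Nullary using (¬_; Dec; yes; no; does; contradiction; ¬?)
open import Relation.Nullary.Decidable using (_×-dec_; _⊎-dec_; dec-true; dec-false)
import Relation.Nullary.Decidable as Dec

open Algebra.Properties.CommutativeSemigroup +-commutativeSemigroup using (interchange)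

does⇒witness : ∀ {A : Set} (a? : Dec A) → does a? ≡ true → A
does⇒witness (yes a) _ = a

-- Residues mod 3 and the balance automaton

rotate : Fin 3 → Fin 3
rotate 0F = 1F
rotate 1F = 2F
rotate 2F = 0F

residue : ℕ → Fin 3
residue zero    = 0F
residue (suc x) = rotate (residue x)

residue-+3 : ∀ x → residue (3 + x) ≡ residue x
residue-+3 x with residue x
... | 0F = refl
... | 1F = refl
... | 2F = refl

toℕ-residue : ∀ x → toℕ (residue x) ≡ x % 3
toℕ-residue 0 = refl
toℕ-residue 1 = refl
toℕ-residue 2 = refl
toℕ-residue (suc (suc (suc x))) = begin
  toℕ (residue (3 + x)) ≡⟨ cong toℕ (residue-+3 x) ⟩
  toℕ (residue x)       ≡⟨ toℕ-residue x ⟩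
  x % 3                 ≡⟨ [m+n]%n≡m%n x 3 ⟨
  (x + 3) % 3           ≡⟨ cong (_% 3) (+-comm x 3) ⟩
  (3 + x) % 3           ∎
  where open ≡-Reasoning

injective⇒surjective : ∀ {n} {f : Fin n → Fin n} → Injective _≡_ _≡_ f → ∀ r → ∃ λ j → f j ≡ r
injective⇒surjective {suc n} {f} f-inj r with any? (λ j → f j ≟ r)
... | yes hit = hit
... | no miss = ⊥-elim collision
  where
  r≢f : ∀ j → r ≢ f j
  r≢f j r≡fj = miss (j , sym r≡fj)
  collision : ⊥
  collision with i , j , i<j , eq ← pigeonhole (n<1+n n) (λ j → punchOut (r≢f j))
    = <⇒≢ i<j (f-inj (punchOut-injective (r≢f i) (r≢f j) eq))

injective⇒∃! : ∀ {n} {f : Fin n → Fin n} → Injective _≡_ _≡_ f → ∀ r → ∃! _≡_ (λ j → f j ≡ r)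
injective⇒∃! f-inj r with j , fj≡r ← injective⇒surjective f-inj r =
  j , fj≡r , λ fj′≡r → f-inj (trans fj≡r (sym fj′≡r))

-- The residues seen in the current triple: none, just r (ahead r), two distinct ones other than r
-- (missing r), or a repetition (broken).
data Balance : Set where
  balanced : Balance
  ahead    : Fin 3 → Balance
  missing  : Fin 3 → Balance
  broken   : Balance

-- Only used on distinct arguments.
third : Fin 3 → Fin 3 → Fin 3
third 0F 1F = 2F
third 0F 2F = 1F
third 1F 0F = 2F
third 1F 2F = 0F
third 2F 0F = 1F
third 2F 1F = 0F
third _  _  = 0F

observe : Fin 3 → Balance → Balance
observe r balanced    = ahead r
observe r (ahead q)   = if does (q ≟ r) then broken else missing (third q r)
observe r (missing q) = if does (q ≟ r) then balanced else broken
observe r broken      = broken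

observeIf : Bool → Fin 3 → Balance → Balance
observeIf true  r s = observe r s
observeIf false r s = s

observeIf-broken : ∀ b r → observeIf b r broken ≡ broken
observeIf-broken true  r = refl
observeIf-broken false r = refl

unbroken-triple : ∀ a b c → observe b (ahead a) ≢ broken → observe c (observe b (ahead a)) ≢ broken →
                  observe c (observe b (ahead a)) ≡ balanced × a ≢ b × b ≢ c × a ≢ c
unbroken-triple 0F 1F 2F _ _ = refl , (λ ()) , (λ ()) , (λ ())
unbroken-triple 0F 2F 1F _ _ = refl , (λ ()) , (λ ()) , (λ ())
unbroken-triple 1F 0F 2F _ _ = refl , (λ ()) , (λ ()) , (λ ())
unbroken-triple 1F 2F 0F _ _ = refl , (λ ()) , (λ ()) , (λ ())
unbroken-triple 2F 0F 1F _ _ = refl , (λ ()) , (λ ()) , (λ ())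
unbroken-triple 2F 1F 0F _ _ = refl , (λ ()) , (λ ()) , (λ ())
unbroken-triple 0F 0F _  ab _ = ⊥-elim (ab refl)
unbroken-triple 1F 1F _  ab _ = ⊥-elim (ab refl)
unbroken-triple 2F 2F _  ab _ = ⊥-elim (ab refl)
unbroken-triple 0F 1F 0F _ abc = ⊥-elim (abc refl)
unbroken-triple 0F 1F 1F _ abc = ⊥-elim (abc refl)
unbroken-triple 0F 2F 0F _ abc = ⊥-elim (abc refl)
unbroken-triple 0F 2F 2F _ abc = ⊥-elim (abc refl)
unbroken-triple 1F 0F 0F _ abc = ⊥-elim (abc refl)
unbroken-triple 1F 0F 1F _ abc = ⊥-elim (abc refl)
unbroken-triple 1F 2F 1F _ abc = ⊥-elim (abc refl)
unbroken-triple 1F 2F 2F _ abc = ⊥-elim (abc refl)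
unbroken-triple 2F 0F 0F _ abc = ⊥-elim (abc refl)
unbroken-triple 2F 0F 2F _ abc = ⊥-elim (abc refl)
unbroken-triple 2F 1F 1F _ abc = ⊥-elim (abc refl)
unbroken-triple 2F 1F 2F _ abc = ⊥-elim (abc refl)

distinct⇒injective : ∀ (f : Fin 3 → Fin 3) → f 0F ≢ f 1F × f 1F ≢ f 2F × f 0F ≢ f 2F →
                     Injective _≡_ _≡_ f
distinct⇒injective f (f0≢f1 , f1≢f2 , f0≢f2) = f-inj
  where
  f-inj : Injective _≡_ _≡_ f
  f-inj {0F} {0F} _ = refl
  f-inj {0F} {1F} e = contradiction e f0≢f1
  f-inj {0F} {2F} e = contradiction e f0≢f2
  f-inj {1F} {0F} e = contradiction (sym e) f0≢f1
  f-inj {1F} {1F} _ = refl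
  f-inj {1F} {2F} e = contradiction e f1≢f2
  f-inj {2F} {0F} e = contradiction (sym e) f0≢f2
  f-inj {2F} {1F} e = contradiction (sym e) f1≢f2
  f-inj {2F} {2F} _ = refl

balance-≟ : DecidableEquality Balance
balance-≟ balanced    balanced    = yes refl
balance-≟ (ahead p)   (ahead q)   = Dec.map′ (cong ahead) (λ { refl → refl }) (p ≟ q)
balance-≟ (missing p) (missing q) = Dec.map′ (cong missing) (λ { refl → refl }) (p ≟ q)
balance-≟ broken      broken      = yes refl
balance-≟ balanced    (ahead _)   = no λ ()
balance-≟ balanced    (missing _) = no λ ()
balance-≟ balanced    broken      = no λ ()
balance-≟ (ahead _)   balanced    = no λ ()
balance-≟ (ahead _)   (missing _) = no λ ()
balance-≟ (ahead _)   broken      = no λ ()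
balance-≟ (missing _) balanced    = no λ ()
balance-≟ (missing _) (ahead _)   = no λ ()
balance-≟ (missing _) broken      = no λ ()
balance-≟ broken      balanced    = no λ ()
balance-≟ broken      (ahead _)   = no λ ()
balance-≟ broken      (missing _) = no λ ()

unbroken : Balance → Bool
unbroken broken = false
unbroken _      = true

unbroken-sound : ∀ {s} → unbroken s ≡ true → s ≢ broken
unbroken-sound {broken} ()

Letter : Set
Letter = Bool × Bool

ScanState : Set
ScanState = Fin 3 × Balance

scanState-≟ : DecidableEquality ScanState
scanState-≟ = ≡-dec _≟_ balance-≟

step : Letter → ScanState → ScanState
step (A , B) (p , s) = rotate (rotate p) , observeIf B (rotate (rotate p)) (observeIf A (rotate p) s)

Unbroken : ScanState → Set
Unbroken z = proj₂ z ≢ broken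

steps : Letter → ℕ → ScanState → ScanState
steps l k z = fold z (step l) k

-- Three equal letters advance the residue by 6 ≡ 0; whether they also restore the balance is decided
-- by computation, once per run.
Cycles : Letter → ScanState → Bool
Cycles l z = unbroken (proj₂ z) ∧ unbroken (proj₂ (step l z)) ∧ unbroken (proj₂ (step l (step l z)))
           ∧ does (scanState-≟ (steps l 3 z) z)

module _ {l z} (cycles : Cycles l z ≡ true) where

  private
    z₁ = step l z
    z₂ = step l z₁
    back = does (scanState-≟ (steps l 3 z) z)
    rest₁ = unbroken (proj₂ z₁) ∧ unbroken (proj₂ z₂) ∧ back
    rest₂ = unbroken (proj₂ z₂) ∧ back
    cycles₁ = ∧-conicalʳ (unbroken (proj₂ z)) rest₁ cycles
    cycles₂ = ∧-conicalʳ (unbroken (proj₂ z₁)) rest₂ cycles₁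

  steps-3 : steps l 3 z ≡ z
  steps-3 = does⇒witness (scanState-≟ _ _) (∧-conicalʳ (unbroken (proj₂ z₂)) back cycles₂)

  steps-3* : ∀ j → steps l (3 * j) z ≡ z
  steps-3* zero    = refl
  steps-3* (suc j) = begin
    steps l (3 * suc j) z            ≡⟨ cong (λ k → steps l k z) (*-suc 3 j) ⟩
    steps l (3 + 3 * j) z            ≡⟨ fold-+ z (step l) 3 {3 * j} ⟩
    steps l 3 (steps l (3 * j) z)    ≡⟨ cong (steps l 3) (steps-3* j) ⟩
    steps l 3 z                      ≡⟨ steps-3 ⟩
    z                                ∎
    where open ≡-Reasoning

  steps-+3* : ∀ r j → steps l (r + 3 * j) z ≡ steps l r z
  steps-+3* r j = trans (fold-+ z (step l) r {3 * j}) (cong (steps l r) (steps-3* j))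

  private
    orbit : ∀ i → steps l i z ≡ z ⊎ steps l i z ≡ z₁ ⊎ steps l i z ≡ z₂
    orbit zero = inj₁ refl
    orbit (suc i) with orbit i
    ... | inj₁ e        = inj₂ (inj₁ (cong (step l) e))
    ... | inj₂ (inj₁ e) = inj₂ (inj₂ (cong (step l) e))
    ... | inj₂ (inj₂ e) = inj₁ (trans (cong (step l) e) steps-3)

  steps-unbroken : ∀ i → Unbroken (steps l i z)
  steps-unbroken i with orbit i
  ... | inj₁ e        = subst Unbroken (sym e) (unbroken-sound (∧-conicalˡ _ rest₁ cycles))
  ... | inj₂ (inj₁ e) = subst Unbroken (sym e) (unbroken-sound (∧-conicalˡ _ rest₂ cycles₁))
  ... | inj₂ (inj₂ e) = subst Unbroken (sym e) (unbroken-sound (∧-conicalˡ _ back cycles₂))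

data Run : Set where
  once   : Letter → Run
  repeat : Letter → (r j : ℕ) → Run

runLength : Run → ℕ
runLength (once _)       = 1
runLength (repeat _ r j) = r + 3 * j

runLetter : Run → Letter
runLetter (once l)       = l
runLetter (repeat l _ _) = l

applyRun : Run → ScanState → ScanState
applyRun (once l)       z = step l z
applyRun (repeat l r _) z = steps l r z

runSafe : Run → ScanState → Bool
runSafe (once l)       z = unbroken (proj₂ (step l z))
runSafe (repeat l _ _) z = Cycles l z

totalLength : List Run → ℕ
totalLength []       = 0
totalLength (r ∷ rs) = runLength r + totalLength rs

applyRuns : List Run → ScanState → ScanState
applyRuns []       z = z
applyRuns (r ∷ rs) z = applyRuns rs (applyRun r z)

runsSafe : List Run → ScanState → Bool
runsSafe []       z = true
runsSafe (r ∷ rs) z = runSafe r z ∧ runsSafe rs (applyRun r z)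

-- Scanning a decidable cofinite set

halve : ℕ → ℕ × Bool
halve zero = 0 , false
halve (suc x) with halve x
... | y , false = y , true
... | y , true  = suc y , false

halve-double : ∀ y → halve (y + y) ≡ (y , false)
halve-double zero    = refl
halve-double (suc y) rewrite +-suc y y | halve-double y = refl

halve-double+1 : ∀ y → halve (suc (y + y)) ≡ (y , true)
halve-double+1 y rewrite halve-double y = refl

parity : ∀ x → (∃ λ y → x ≡ y + y) ⊎ (∃ λ y → x ≡ suc (y + y))
parity zero = inj₁ (0 , refl)
parity (suc x) with parity x
... | inj₁ (y , refl) = inj₂ (y , refl)
... | inj₂ (y , refl) = inj₁ (suc y , cong suc (sym (+-suc y y)))

module Enumeration (member : ℕ → Bool) (bound : ℕ) (cofinite : ∀ x → bound ≤ x → member x ≡ true) where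

  record LeastMemberFrom (s y : ℕ) : Set where
    field
      is-member : member y ≡ true
      from≤     : s ≤ y
      skipped   : ∀ z → s ≤ z → z < y → member z ≡ false

  open LeastMemberFrom

  least-unique : ∀ {s y y′} → LeastMemberFrom s y → LeastMemberFrom s y′ → y ≡ y′
  least-unique {y = y} {y′} p p′ with <-cmp y y′
  ... | tri≈ _ y≡y′ _ = y≡y′
  ... | tri< y<y′ _ _ with () ← trans (sym (is-member p)) (skipped p′ y (from≤ p) y<y′)
  ... | tri> _ _ y′<y with () ← trans (sym (is-member p′)) (skipped p y′ (from≤ p′) y′<y)

  firstFrom : (fuel s : ℕ) → ℕ
  firstFrom zero       s = s
  firstFrom (suc fuel) s = if member s then s else firstFrom fuel (suc s)

  firstFrom-least : ∀ fuel s → bound ≤ s + fuel → LeastMemberFrom s (firstFrom fuel s)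
  firstFrom-least zero s bound≤s = record
    { is-member = cofinite s (subst (bound ≤_) (+-identityʳ s) bound≤s)
    ; from≤     = ≤-refl
    ; skipped   = λ z s≤z z<s → contradiction s≤z (<⇒≱ z<s) }
  firstFrom-least (suc fuel) s bound≤ with member s in eq
  ... | true  = record
    { is-member = eq
    ; from≤     = ≤-refl
    ; skipped   = λ z s≤z z<s → contradiction s≤z (<⇒≱ z<s) }
  ... | false = record
    { is-member = is-member rest
    ; from≤     = ≤-trans (n≤1+n s) (from≤ rest)
    ; skipped   = skip }
    where
    rest = firstFrom-least fuel (suc s) (subst (bound ≤_) (+-suc s fuel) bound≤)
    skip : ∀ z → s ≤ z → z < firstFrom fuel (suc s) → member z ≡ false
    skip z s≤z z<y with m≤n⇒m<n∨m≡n s≤z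
    ... | inj₁ s<z  = skipped rest z s<z z<y
    ... | inj₂ refl = eq

  next : ℕ → ℕ
  next x = firstFrom bound (suc x)

  next-least : ∀ x → LeastMemberFrom (suc x) (next x)
  next-least x = firstFrom-least bound (suc x) (m≤n+m bound (suc x))

  next-unique : ∀ {x y} → LeastMemberFrom (suc x) y → next x ≡ y
  next-unique = least-unique (next-least _)

  enum : ℕ → ℕ
  enum zero    = 0
  enum (suc i) = next (enum i)

  enum-increasing : ∀ i → enum i < enum (suc i)
  enum-increasing i = from≤ (next-least (enum i))

  enum-member : member 0 ≡ true → ∀ i → member (enum i) ≡ true
  enum-member member-0 zero    = member-0
  enum-member member-0 (suc i) = is-member (next-least (enum i))

  enum-bracket : ∀ x → ∃ λ i → enum i ≤ x × x < enum (suc i)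
  enum-bracket zero = 0 , z≤n , enum-increasing 0
  enum-bracket (suc x) with enum-bracket x
  ... | i , gi≤x , x<gi+1 with m≤n⇒m<n∨m≡n x<gi+1
  ... | inj₁ x+1<gi+1 = i , ≤-trans gi≤x (n≤1+n x) , x+1<gi+1
  ... | inj₂ x+1≡gi+1 = suc i , ≤-reflexive (sym x+1≡gi+1) ,
                        subst (_< enum (suc (suc i))) (sym x+1≡gi+1) (enum-increasing (suc i))

  enum-surjective : ∀ x → member x ≡ true → ∃ λ i → enum i ≡ x
  enum-surjective x x∈ with enum-bracket x
  ... | i , gi≤x , x<gi+1 with m≤n⇒m<n∨m≡n gi≤x
  ... | inj₂ gi≡x = i , gi≡x
  ... | inj₁ gi<x with () ← trans (sym x∈) (skipped (next-least (enum i)) x gi<x x<gi+1)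

  scan : ℕ → Balance
  scan zero    = balanced
  scan (suc x) = observeIf (member (suc x)) (residue (suc x)) (scan x)

  scan-skip : ∀ x d → (∀ z → x < z → z ≤ x + d → member z ≡ false) → scan (x + d) ≡ scan x
  scan-skip x zero    _   = cong scan (+-identityʳ x)
  scan-skip x (suc d) gap = begin
    scan (x + suc d)
      ≡⟨ cong scan (+-suc x d) ⟩
    observeIf (member (suc (x + d))) (residue (suc (x + d))) (scan (x + d))
      ≡⟨ cong (λ b → observeIf b (residue (suc (x + d))) (scan (x + d)))
              (gap (suc (x + d)) (s≤s (m≤m+n x d)) (≤-reflexive (sym (+-suc x d)))) ⟩
    scan (x + d)
      ≡⟨ scan-skip x d (λ z x<z z≤x+d → gap z x<z (≤-trans z≤x+d (+-monoʳ-≤ x (n≤1+n d)))) ⟩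
    scan x ∎
    where open ≡-Reasoning

  scan-next : ∀ x → scan (next x) ≡ observe (residue (next x)) (scan x)
  scan-next x with d , x+1+d≡y ← m≤n⇒∃[o]m+o≡n (from≤ (next-least x)) = begin
    scan (next x)
      ≡⟨ cong scan (sym x+1+d≡y) ⟩
    observeIf (member (suc (x + d))) (residue (suc (x + d))) (scan (x + d))
      ≡⟨ cong₂ (λ b y → observeIf b (residue y) (scan (x + d)))
               (trans (cong member x+1+d≡y) (is-member least)) x+1+d≡y ⟩
    observe (residue (next x)) (scan (x + d))
      ≡⟨ cong (observe _) (scan-skip x d gap) ⟩
    observe (residue (next x)) (scan x) ∎
    where
    open ≡-Reasoning
    least = next-least x
    gap : ∀ z → x < z → z ≤ x + d → member z ≡ false
    gap z x<z z≤x+d = skipped least z x<z (subst (z <_) x+1+d≡y (s≤s z≤x+d))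

  blockResidue : ℕ → Fin 3 → Fin 3
  blockResidue i l = residue (enum (suc (toℕ l) + i))

  toℕ-blockResidue : ∀ i l → toℕ (blockResidue i l) ≡ enum (i + suc (toℕ l)) % 3
  toℕ-blockResidue i l =
    trans (toℕ-residue (enum (suc (toℕ l) + i))) (cong (λ x → enum x % 3) (+-comm (suc (toℕ l)) i))

  module _ (unbroken : ∀ x → scan x ≢ broken) where

    balanced-block : ∀ i → scan (enum i) ≡ balanced →
                     scan (enum (3 + i)) ≡ balanced × Injective _≡_ _≡_ (blockResidue i)
    balanced-block i balanced-i =
      conclude (unbroken-triple a b c (λ e → unbroken (enum (2 + i)) (trans s₂ e))
                                      (λ e → unbroken (enum (3 + i)) (trans s₃ e)))
      where
      a = blockResidue i 0F
      b = blockResidue i 1F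
      c = blockResidue i 2F
      s₁ : scan (enum (1 + i)) ≡ ahead a
      s₁ = trans (scan-next (enum i)) (cong (observe a) balanced-i)
      s₂ : scan (enum (2 + i)) ≡ observe b (ahead a)
      s₂ = trans (scan-next (enum (1 + i))) (cong (observe b) s₁)
      s₃ : scan (enum (3 + i)) ≡ observe c (observe b (ahead a))
      s₃ = trans (scan-next (enum (2 + i))) (cong (observe c) s₂)
      conclude : observe c (observe b (ahead a)) ≡ balanced × a ≢ b × b ≢ c × a ≢ c →
                 scan (enum (3 + i)) ≡ balanced × Injective _≡_ _≡_ (blockResidue i)
      conclude (back , distinct) = trans s₃ back , distinct⇒injective (blockResidue i) distinct

    scan-balanced : ∀ j → scan (enum (j * 3)) ≡ balanced
    scan-balanced zero    = refl
    scan-balanced (suc j) = proj₁ (balanced-block (j * 3) (scan-balanced j))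

    residues-permuted : ∀ j r → ∃! _≡_ (λ (l : Fin 3) → enum (j * 3 + suc (toℕ l)) % 3 ≡ toℕ r)
    residues-permuted j r = transport (injective⇒∃! (proj₂ (balanced-block (j * 3) (scan-balanced j))) r)
      where
      transport : ∃! _≡_ (λ l → blockResidue (j * 3) l ≡ r) →
                  ∃! _≡_ (λ (l : Fin 3) → enum (j * 3 + suc (toℕ l)) % 3 ≡ toℕ r)
      transport (l , bl≡r , unique) =
        l , trans (sym (toℕ-blockResidue (j * 3) l)) (cong toℕ bl≡r) ,
        λ {l′} e → unique (toℕ-injective (trans (toℕ-blockResidue (j * 3) l′) e))

  letter : ℕ → Letter
  letter y = member (y + y) , member (suc (y + y))

  snapshot : ℕ → ScanState
  snapshot y = residue (suc (y + y)) , scan (suc (y + y))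

  snapshot-suc : ∀ y → snapshot (suc y) ≡ step (letter (suc y)) (snapshot y)
  snapshot-suc y rewrite +-suc y y = refl

  Constant : ℕ → ℕ → Letter → Set
  Constant y len l = ∀ i → i < len → letter (suc (y + i)) ≡ l

  snapshot-steps : ∀ {y len l} → Constant y len l →
                   ∀ i → i ≤ len → snapshot (y + i) ≡ steps l i (snapshot y)
  snapshot-steps {y} constant zero    _       = cong snapshot (+-identityʳ y)
  snapshot-steps {y} {l = l} constant (suc i) 1+i≤len = begin
    snapshot (y + suc i)                           ≡⟨ cong snapshot (+-suc y i) ⟩
    snapshot (suc (y + i))                         ≡⟨ snapshot-suc (y + i) ⟩
    step (letter (suc (y + i))) (snapshot (y + i)) ≡⟨ cong₂ step (constant i 1+i≤len)
                                                        (snapshot-steps constant i (≤-trans (n≤1+n i) 1+i≤len)) ⟩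
    step l (steps l i (snapshot y))                ∎
    where open ≡-Reasoning

  run-sound : ∀ {y} r → Constant y (runLength r) (runLetter r) → Unbroken (snapshot y) →
              runSafe r (snapshot y) ≡ true →
              snapshot (y + runLength r) ≡ applyRun r (snapshot y) ×
              (∀ i → i ≤ runLength r → Unbroken (snapshot (y + i)))
  run-sound {y} (once l) constant unbroken-y safe = after , unbroken-within
    where
    after : snapshot (y + 1) ≡ step l (snapshot y)
    after = snapshot-steps constant 1 ≤-refl
    unbroken-within : ∀ i → i ≤ 1 → Unbroken (snapshot (y + i))
    unbroken-within zero    _ = subst (Unbroken ∘ snapshot) (sym (+-identityʳ y)) unbroken-y
    unbroken-within (suc zero) _ = subst Unbroken (sym after) (unbroken-sound safe)
    unbroken-within (suc (suc _)) (s≤s ())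
  run-sound {y} (repeat l r j) constant _ cycles =
    trans (within (r + 3 * j) ≤-refl) (steps-+3* {l} {snapshot y} cycles r j) ,
    λ i i≤len → subst Unbroken (sym (within i i≤len)) (steps-unbroken {l} {snapshot y} cycles i)
    where
    within : ∀ i → i ≤ r + 3 * j → snapshot (y + i) ≡ steps l i (snapshot y)
    within = snapshot-steps {len = r + 3 * j} {l} constant

  SpelledRun : ℕ → ℕ → Run → Set
  SpelledRun y off (once l)       = letter (suc (y + (off + 0))) ≡ l
  SpelledRun y off (repeat l r j) = ∀ i → i < r + 3 * j → letter (suc (y + (off + i))) ≡ l

  spelled-letters : ∀ {y off} r → SpelledRun y off r →
                    ∀ i → i < runLength r → letter (suc (y + (off + i))) ≡ runLetter r
  spelled-letters (once l)       at-0    zero    _        = at-0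
  spelled-letters (once l)       _       (suc _) (s≤s ())
  spelled-letters (repeat l r j) letters               = letters

  Spells : ℕ → ℕ → List Run → Set
  Spells y off []       = ⊤
  Spells y off (r ∷ rs) = SpelledRun y off r × Spells y (off + runLength r) rs

  runs-sound : ∀ y off rs → Spells y off rs → Unbroken (snapshot (y + off)) →
               runsSafe rs (snapshot (y + off)) ≡ true →
               snapshot (y + (off + totalLength rs)) ≡ applyRuns rs (snapshot (y + off)) ×
               (∀ i → i ≤ totalLength rs → Unbroken (snapshot (y + (off + i))))
  runs-sound y off [] _ unbroken-start _ =
    cong (λ k → snapshot (y + k)) (+-identityʳ off) ,
    λ { zero _ → subst (λ k → Unbroken (snapshot (y + k))) (sym (+-identityʳ off)) unbroken-start }
  runs-sound y off (r ∷ rs) (spelled , spelled-rest) unbroken-start safe = after , unbroken-within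
    where
    open ≡-Reasoning
    start = y + off
    middle = off + runLength r
    constant : Constant start (runLength r) (runLetter r)
    constant i i<len = trans (cong (λ k → letter (suc k)) (+-assoc y off i)) (spelled-letters r spelled i i<len)
    first = run-sound r constant unbroken-start (∧-conicalˡ (runSafe r _) _ safe)
    start+len≡ : start + runLength r ≡ y + middle
    start+len≡ = +-assoc y off (runLength r)
    first-end : snapshot (y + middle) ≡ applyRun r (snapshot start)
    first-end = trans (cong snapshot (sym start+len≡)) (proj₁ first)
    rest = runs-sound y middle rs spelled-rest
             (subst (Unbroken ∘ snapshot) start+len≡ (proj₂ first (runLength r) ≤-refl))
             (subst (λ z → runsSafe rs z ≡ true) (sym first-end) (∧-conicalʳ (runSafe r _) _ safe))
    after : snapshot (y + (off + (runLength r + totalLength rs))) ≡ applyRuns rs (applyRun r (snapshot start))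
    after = begin
      snapshot (y + (off + (runLength r + totalLength rs)))
        ≡⟨ cong (λ k → snapshot (y + k)) (+-assoc off (runLength r) _) ⟨
      snapshot (y + (middle + totalLength rs))             ≡⟨ proj₁ rest ⟩
      applyRuns rs (snapshot (y + middle))                  ≡⟨ cong (applyRuns rs) first-end ⟩
      applyRuns rs (applyRun r (snapshot start))            ∎
    unbroken-within : ∀ i → i ≤ runLength r + totalLength rs → Unbroken (snapshot (y + (off + i)))
    unbroken-within i i≤ with i ≤? runLength r
    ... | yes i≤len = subst (Unbroken ∘ snapshot) (+-assoc y off i) (proj₂ first i i≤len)
    ... | no  i≰len with d , len+d≡i ← m≤n⇒∃[o]m+o≡n (<⇒≤ (≰⇒> i≰len)) =
      subst (λ k → Unbroken (snapshot (y + k))) (trans (+-assoc off (runLength r) d) (cong (off +_) len+d≡i))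
        (proj₂ rest d (+-cancelˡ-≤ (runLength r) d _
          (subst (_≤ runLength r + totalLength rs) (sym len+d≡i) i≤)))

  constant-forever : ∀ {y l} → (∀ i → letter (suc (y + i)) ≡ l) → Cycles l (snapshot y) ≡ true →
                     ∀ i → Unbroken (snapshot (y + i))
  constant-forever {y} {l} constant cycles i =
    subst Unbroken (sym (snapshot-steps {len = suc i} {l} (λ j _ → constant j) i (n≤1+n i)))
      (steps-unbroken {l} {snapshot y} cycles i)

  snapshots-unbroken : (∀ y → Unbroken (snapshot y)) → ∀ x → scan x ≢ broken
  snapshots-unbroken unbroken-everywhere x with parity x
  ... | inj₂ (y , refl) = unbroken-everywhere y
  ... | inj₁ (y , refl) = λ broken-2y → unbroken-everywhere y
          (trans (cong (observeIf (member (suc (y + y))) (residue (suc (y + y)))) broken-2y)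
                 (observeIf-broken (member (suc (y + y))) (residue (suc (y + y)))))

-- The semigroup ⟨6k + 1, 12k - 4, 12k⟩

⟨⟩-closed : ∀ {m} {g : Fin m → ℕ} {x y} → ⟨ g ⟩ x → ⟨ g ⟩ y → ⟨ g ⟩ (x + y)
⟨⟩-closed {x = x} x∈ gen-zero          = subst ⟨ _ ⟩ (sym (+-identityʳ x)) x∈
⟨⟩-closed {g = g} {x} x∈ (gen-add {y} y∈ i) =
  subst ⟨ g ⟩ (+-assoc x y (g i)) (gen-add (⟨⟩-closed x∈ y∈) i)

⟨⟩-cong : ∀ {m} {f g : Fin m → ℕ} → (∀ i → f i ≡ g i) → ∀ {x} → ⟨ f ⟩ x → ⟨ g ⟩ x
⟨⟩-cong f≗g gen-zero = gen-zero
⟨⟩-cong {g = g} f≗g (gen-add {x} x∈ i) =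
  subst (λ k → ⟨ g ⟩ (x + k)) (sym (f≗g i)) (gen-add (⟨⟩-cong f≗g x∈) i)

digit-shift : ∀ t M s d → (t + M * d) + (s + d) ≡ (s + t) + suc M * d
digit-shift = solve-∀

≤-witness : ∀ {a b} d → a + d ≡ b → a ≤ b
≤-witness {a} d refl = m≤m+n a d

<-witness : ∀ {a b} d → suc (a + d) ≡ b → a < b
<-witness {a} d refl = s≤s (m≤m+n a d)

<-offset : ∀ T {i len X} → i < len → T + len ≡ X → T + i < X
<-offset T i<len refl = +-monoʳ-< T i<len

≤-offset : ∀ T {i len X} → i < len → T + len ≡ suc X → T + i ≤ X
≤-offset T i<len e = ≤-pred (<-offset T i<len e)

2≤⇒≢1 : ∀ {x} → 2 ≤ x → x ≢ 1
2≤⇒≢1 (s≤s ()) refl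

double-≤-cancel : ∀ {y z} → z + z ≤ y + y → z ≤ y
double-≤-cancel {y} {z} 2z≤2y with z ≤? y
... | yes z≤y = z≤y
... | no  z≰y = contradiction 2z≤2y (<⇒≱ (+-mono-< (≰⇒> z≰y) (≰⇒> z≰y)))

double-<-cancel : ∀ {y z} → z + z < y + y → z < y
double-<-cancel {y} {z} 2z<2y with z <? y
... | yes z<y = z<y
... | no  z≮y = contradiction 2z<2y (≤⇒≯ (+-mono-≤ (≮⇒≥ z≮y) (≮⇒≥ z≮y)))

-- The ring solver treats named constants as atoms, so identities it proves mention D, K, … unfolded.
module Semigroup (n : ℕ) where

  D K L a b c : ℕ
  D = 10 + 6 * n
  K = 6 + 3 * n
  L = 5 + 2 * n
  a = 13 + 6 * n
  b = 20 + 12 * n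
  c = 24 + 12 * n

  generator : Fin 3 → ℕ
  generator = lookup (a ∷ b ∷ c ∷ [])

  G : ℕ → Set
  G = ⟨ generator ⟩

  b≡D+D : 20 + 12 * n ≡ (10 + 6 * n) + (10 + 6 * n)
  b≡D+D = solve (n List.∷ List.[])

  c≡[2+D]+[2+D] : 24 + 12 * n ≡ (12 + 6 * n) + (12 + 6 * n)
  c≡[2+D]+[2+D] = solve (n List.∷ List.[])

  a≡1+K+K : 13 + 6 * n ≡ suc ((6 + 3 * n) + (6 + 3 * n))
  a≡1+K+K = solve (n List.∷ List.[])

  3[4+2n]≡2+D : 3 * (4 + 2 * n) ≡ 2 + (10 + 6 * n)
  3[4+2n]≡2+D = solve (n List.∷ List.[])

  -- t + M·D ∈ ⟨D, D + 2, D + 3⟩: t is a sum of M terms from {0, 2, 3}, or t = 1 with a D borrowed.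
  Admissible : ℕ → ℕ → Set
  Admissible M t = t ≤ 3 * M × (t ≢ 1 ⊎ L ≤ M)

  admissible? : ∀ M t → Dec (Admissible M t)
  admissible? M t = (t ≤? 3 * M) ×-dec (¬? (t ≟ℕ 1) ⊎-dec (L ≤? M))

  admissible : ℕ → ℕ → Bool
  admissible M t = does (admissible? M t)

  InH : ℕ → Set
  InH m = ∃₂ λ M t → m ≡ t + M * D × Admissible M t

  inH : ℕ → Bool
  inH m = admissible (m / D) (m % D)

  inH-digits : ∀ M t → t < D → inH (t + M * D) ≡ admissible M t
  inH-digits M t t<D = cong₂ admissible quotient remainder
    where
    remainder : (t + M * D) % D ≡ t
    remainder = trans ([m+kn]%n≡m%n t M D) (m<n⇒m%n≡m t<D)
    quotient : (t + M * D) / D ≡ M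
    quotient = begin
      (t + M * D) / D     ≡⟨ +-distrib-/ t (M * D) digits<D ⟩
      t / D + M * D / D   ≡⟨ cong₂ _+_ (m<n⇒m/n≡0 t<D) (m*n/n≡m M D) ⟩
      M                   ∎
      where
      open ≡-Reasoning
      digits<D : t % D + M * D % D < D
      digits<D = subst (_< D) (sym (trans (cong₂ _+_ (m<n⇒m%n≡m t<D) (m*n%n≡0 M D)) (+-identityʳ t))) t<D

  large-offset⇒large-quotient : ∀ M → 1 + D ≤ 3 * M → 4 + 2 * n ≤ M
  large-offset⇒large-quotient M 1+D≤3M with 4 + 2 * n ≤? M
  ... | yes M-large = M-large
  ... | no  M-small = contradiction 1+D≤3M (<⇒≱ (m≤n⇒m≤1+n (s≤s 3M≤9+6n)))
    where
    triple : 3 * (3 + 2 * n) ≡ 9 + 6 * n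
    triple = solve (n List.∷ List.[])
    3M≤9+6n : 3 * M ≤ 9 + 6 * n
    3M≤9+6n = ≤-trans (*-monoʳ-≤ 3 (≤-pred (≰⇒> M-small))) (≤-reflexive triple)

  carry : ∀ M t → Admissible M t → Admissible (t / D + M) (t % D)
  carry M t (t≤3M , condition) =
    ≤-trans (m%n≤m t D) (≤-trans t≤3M (*-monoʳ-≤ 3 (m≤n+m M (t / D)))) , condition′
    where
    condition′ : t % D ≢ 1 ⊎ L ≤ t / D + M
    condition′ with t / D in quotient | t % D ≟ℕ 1
    ... | zero  | _        = subst (λ r → r ≢ 1 ⊎ L ≤ M) t≡r condition
      where
      t≡r : t ≡ t % D
      t≡r = trans (m≡m%n+[m/n]*n t D) (trans (cong (λ q → t % D + q * D) quotient) (+-identityʳ (t % D)))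
    ... | suc q | no  r≢1 = inj₁ r≢1
    ... | suc q | yes r≡1 = inj₂ (s≤s (≤-trans (large-offset⇒large-quotient M 1+D≤3M) (m≤n+m M q)))
      where
      1+D≤t : 1 + D ≤ t
      1+D≤t = subst (1 + D ≤_) (sym (trans (m≡m%n+[m/n]*n t D) (cong₂ (λ r q → r + q * D) r≡1 quotient)))
                (s≤s (m≤m+n D (q * D)))
      1+D≤3M : 1 + D ≤ 3 * M
      1+D≤3M = ≤-trans 1+D≤t t≤3M

  InH⇒inH : ∀ {m} → InH m → inH m ≡ true
  InH⇒inH (M , t , refl , admissible-M-t) = begin
    inH (t + M * D)                      ≡⟨ cong inH digits ⟩
    inH (t % D + (t / D + M) * D)        ≡⟨ inH-digits (t / D + M) (t % D) (m%n<n t D) ⟩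
    admissible (t / D + M) (t % D)       ≡⟨ dec-true (admissible? _ _) (carry M t admissible-M-t) ⟩
    true                                 ∎
    where
    open ≡-Reasoning
    digits : t + M * D ≡ t % D + (t / D + M) * D
    digits = begin
      t + M * D                  ≡⟨ cong (_+ M * D) (m≡m%n+[m/n]*n t D) ⟩
      (t % D + t / D * D) + M * D ≡⟨ +-assoc (t % D) (t / D * D) (M * D) ⟩
      t % D + (t / D * D + M * D) ≡⟨ cong (t % D +_) (*-distribʳ-+ D (t / D) M) ⟨
      t % D + (t / D + M) * D    ∎

  inH⇒InH : ∀ m → inH m ≡ true → InH m
  inH⇒InH m m∈ = m / D , m % D , m≡m%n+[m/n]*n m D , does⇒witness (admissible? _ _) m∈

  InH-+D : ∀ {m} → InH m → InH (m + D)
  InH-+D (M , t , refl , t≤3M , condition) =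
    suc M , t , digit-shift t M 0 D ,
    ≤-trans t≤3M (*-monoʳ-≤ 3 (n≤1+n M)) , Sum.map₂ (λ L≤M → ≤-trans L≤M (n≤1+n M)) condition

  InH-+D+s : ∀ {m} s → 2 ≤ s → s ≤ 3 → InH m → InH (m + (s + D))
  InH-+D+s s 2≤s s≤3 (M , t , refl , t≤3M , _) =
    suc M , s + t , digit-shift t M s D , ≤-trans (+-mono-≤ s≤3 t≤3M) (≤-reflexive (sym (*-suc 3 M))) ,
    inj₁ (2≤⇒≢1 (≤-trans 2≤s (m≤m+n s t)))

  GForm : ℕ → Set
  GForm x = (∃ λ m → x ≡ m + m × InH m) ⊎ (∃ λ m → x ≡ a + (m + m) × InH m)

  G⇒GForm : ∀ {x} → G x → GForm x
  G⇒GForm gen-zero = inj₁ (0 , refl , 0 , 0 , refl , z≤n , inj₁ λ ())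
  G⇒GForm (gen-add x∈ i) = add (G⇒GForm x∈) i
    where
    even+double : ∀ m d → (m + m) + (d + d) ≡ (m + d) + (m + d)
    even+double m d = interchange m m d d
    odd+double : ∀ m d → (a + (m + m)) + (d + d) ≡ a + ((m + d) + (m + d))
    odd+double m d = trans (+-assoc a (m + m) (d + d)) (cong (a +_) (even+double m d))
    odd+a : ∀ m → (a + (m + m)) + a ≡ (m + a) + (m + a)
    odd+a m = solve (m List.∷ n List.∷ List.[])
    add : ∀ {x} → GForm x → ∀ i → GForm (x + generator i)
    add (inj₁ (m , refl , m∈)) 0F = inj₂ (m , +-comm (m + m) a , m∈)
    add (inj₂ (m , refl , m∈)) 0F = inj₁ (m + a , odd+a m , InH-+D+s 3 (s≤s (s≤s z≤n)) ≤-refl m∈)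
    add (inj₁ (m , refl , m∈)) 1F =
      inj₁ (m + D , trans (cong (m + m +_) b≡D+D) (even+double m D) , InH-+D m∈)
    add (inj₂ (m , refl , m∈)) 1F =
      inj₂ (m + D , trans (cong (a + (m + m) +_) b≡D+D) (odd+double m D) , InH-+D m∈)
    add (inj₁ (m , refl , m∈)) 2F =
      inj₁ (m + (2 + D) , trans (cong (m + m +_) c≡[2+D]+[2+D]) (even+double m (2 + D)) ,
            InH-+D+s 2 ≤-refl (s≤s (s≤s z≤n)) m∈)
    add (inj₂ (m , refl , m∈)) 2F =
      inj₂ (m + (2 + D) , trans (cong (a + (m + m) +_) c≡[2+D]+[2+D]) (odd+double m (2 + D)) ,
            InH-+D+s 2 ≤-refl (s≤s (s≤s z≤n)) m∈)

  G-double : ∀ {x y} → G (x + x) → G (y + y) → G ((x + y) + (x + y))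
  G-double {x} {y} x∈ y∈ = subst G (interchange x x y y) (⟨⟩-closed x∈ y∈)

  G-double-carry : ∀ M t s → G ((t + M * D) + (t + M * D)) → G ((s + D) + (s + D)) →
                   G (((s + t) + suc M * D) + ((s + t) + suc M * D))
  G-double-carry M t s low∈ digit∈ =
    subst G (cong₂ _+_ (digit-shift t M s D) (digit-shift t M s D)) (G-double {t + M * D} {s + D} low∈ digit∈)

  [0+D]+[0+D]∈G : G ((0 + D) + (0 + D))
  [0+D]+[0+D]∈G = subst G b≡D+D (gen-add gen-zero 1F)

  [2+D]+[2+D]∈G : G ((2 + D) + (2 + D))
  [2+D]+[2+D]∈G = subst G c≡[2+D]+[2+D] (gen-add gen-zero 2F)

  [3+D]+[3+D]∈G : G ((3 + D) + (3 + D))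
  [3+D]+[3+D]∈G = gen-add (gen-add gen-zero 0F) 0F

  admissible-double∈G : ∀ M t → t ≤ 3 * M → t ≢ 1 → G ((t + M * D) + (t + M * D))
  admissible-double∈G zero    zero    _  _ = gen-zero
  admissible-double∈G (suc M) 0       _  _ =
    G-double-carry M 0 0 (admissible-double∈G M 0 z≤n λ ()) [0+D]+[0+D]∈G
  admissible-double∈G (suc M) 1       _  t≢1 = contradiction refl t≢1
  admissible-double∈G (suc M) 2       _  _ =
    G-double-carry M 0 2 (admissible-double∈G M 0 z≤n λ ()) [2+D]+[2+D]∈G
  admissible-double∈G (suc M) 3       _  _ =
    G-double-carry M 0 3 (admissible-double∈G M 0 z≤n λ ()) [3+D]+[3+D]∈G
  admissible-double∈G (suc zero) 4 (s≤s (s≤s (s≤s ()))) _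
  admissible-double∈G (suc (suc M)) 4 _ _ =
    G-double-carry (suc M) 2 2
      (admissible-double∈G (suc M) 2 (subst (2 ≤_) (sym (*-suc 3 M)) (s≤s (s≤s z≤n))) λ ())
      [2+D]+[2+D]∈G
  admissible-double∈G (suc M) (suc (suc (suc (suc (suc u))))) 5+u≤3+3M _ =
    G-double-carry M (2 + u) 3
      (admissible-double∈G M (2 + u) (≤-pred (≤-pred (≤-pred (subst (5 + u ≤_) (*-suc 3 M) 5+u≤3+3M)))) λ ())
      [3+D]+[3+D]∈G

  InH⇒double∈G : ∀ {m} → InH m → G (m + m)
  InH⇒double∈G (M , t , refl , t≤3M , inj₁ t≢1) = admissible-double∈G M t t≤3M t≢1
  InH⇒double∈G (M , t , refl , t≤3M , inj₂ L≤M) with t ≟ℕ 1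
  ... | no  t≢1  = admissible-double∈G M t t≤3M t≢1
  ... | yes refl = borrow M L≤M
    where
    borrow : ∀ M → L ≤ M → G ((1 + M * D) + (1 + M * D))
    borrow (suc M) (s≤s 4+2n≤M) = admissible-double∈G M (suc D) 1+D≤3M λ ()
      where
      1+D≤3M : suc D ≤ 3 * M
      1+D≤3M = ≤-trans (n≤1+n (suc D)) (subst (_≤ 3 * M) 3[4+2n]≡2+D (*-monoʳ-≤ 3 4+2n≤M))

  GForm⇒G : ∀ {x} → GForm x → G x
  GForm⇒G (inj₁ (m , refl , m∈)) = InH⇒double∈G m∈
  GForm⇒G (inj₂ (m , refl , m∈)) = subst G (+-comm (m + m) a) (gen-add (InH⇒double∈G m∈) 0F)

  inG-halves : ℕ × Bool → Bool
  inG-halves (y , false) = inH y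
  inG-halves (y , true)  = does (K ≤? y) ∧ inH (y ∸ K)

  inG : ℕ → Bool
  inG x = inG-halves (halve x)

  inG-even : ∀ y → inG (y + y) ≡ inH y
  inG-even y = cong inG-halves (halve-double y)

  inG-odd : ∀ y → inG (suc (y + y)) ≡ does (K ≤? y) ∧ inH (y ∸ K)
  inG-odd y = cong inG-halves (halve-double+1 y)

  odd-form : ∀ m → a + (m + m) ≡ suc ((K + m) + (K + m))
  odd-form m = trans (cong (_+ (m + m)) a≡1+K+K) (cong suc (interchange K K m m))

  odd-form-∸ : ∀ {y} → K ≤ y → suc (y + y) ≡ a + ((y ∸ K) + (y ∸ K))
  odd-form-∸ {y} K≤y = trans (cong (λ z → suc (z + z)) (sym (m+[n∸m]≡n K≤y))) (sym (odd-form (y ∸ K)))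

  GForm⇒inG : ∀ {x} → GForm x → inG x ≡ true
  GForm⇒inG (inj₁ (m , refl , m∈)) = trans (inG-even m) (InH⇒inH m∈)
  GForm⇒inG (inj₂ (m , refl , m∈)) = begin
    inG (a + (m + m))                              ≡⟨ cong inG (odd-form m) ⟩
    inG (suc ((K + m) + (K + m)))                  ≡⟨ inG-odd (K + m) ⟩
    does (K ≤? K + m) ∧ inH ((K + m) ∸ K)          ≡⟨ cong₂ _∧_ (dec-true (K ≤? K + m) (m≤m+n K m))
                                                                (cong inH (m+n∸m≡n K m)) ⟩
    inH m                                          ≡⟨ InH⇒inH m∈ ⟩
    true                                           ∎
    where open ≡-Reasoning

  inG⇒GForm : ∀ x → inG x ≡ true → GForm x
  inG⇒GForm x x∈ with parity x
  ... | inj₁ (y , refl) = inj₁ (y , refl , inH⇒InH y (trans (sym (inG-even y)) x∈))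
  ... | inj₂ (y , refl) =
    inj₂ (y ∸ K , odd-form-∸ (does⇒witness (K ≤? y) (∧-conicalˡ _ (inH (y ∸ K)) both)) ,
          inH⇒InH (y ∸ K) (∧-conicalʳ (does (K ≤? y)) _ both))
    where
    both : does (K ≤? y) ∧ inH (y ∸ K) ≡ true
    both = trans (sym (inG-odd y)) x∈

  G⇔inG : ∀ x → (G x → inG x ≡ true) × (inG x ≡ true → G x)
  G⇔inG x = (λ x∈ → GForm⇒inG (G⇒GForm x∈)) , (λ x∈ → GForm⇒G (inG⇒GForm x x∈))

  W : ℕ
  W = (4 + 2 * n) * D + 2

  large⇒InH : ∀ m → W ≤ m → InH m
  large⇒InH m W≤m = M , t , m≡m%n+[m/n]*n m D , t≤3M , condition
    where
    M = m / D
    t = m % D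
    4+2n≤M : 4 + 2 * n ≤ M
    4+2n≤M = subst (_≤ M) (m*n/n≡m (4 + 2 * n) D) (/-monoˡ-≤ D (≤-trans (m≤m+n ((4 + 2 * n) * D) 2) W≤m))
    t≤3M : t ≤ 3 * M
    t≤3M = ≤-trans (<⇒≤ (m%n<n m D))
             (≤-trans (m≤n+m D 2) (subst (_≤ 3 * M) 3[4+2n]≡2+D (*-monoʳ-≤ 3 4+2n≤M)))
    condition : t ≢ 1 ⊎ L ≤ M
    condition with L ≤? M
    ... | yes L≤M = inj₂ L≤M
    ... | no  L≰M = inj₁ λ t≡1 → <⇒≱ (m<W t≡1) W≤m
      where
      m<W : t ≡ 1 → m < W
      m<W t≡1 = begin-strict
        m            ≡⟨ m≡m%n+[m/n]*n m D ⟩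
        t + M * D    ≡⟨ cong (_+ M * D) t≡1 ⟩
        1 + M * D    ≤⟨ s≤s (*-monoˡ-≤ D (≤-pred (≰⇒> L≰M))) ⟩
        1 + (4 + 2 * n) * D <⟨ ≤-reflexive (+-comm 2 ((4 + 2 * n) * D)) ⟩
        W            ∎
        where open ≤-Reasoning

  bound : ℕ
  bound = a + (W + W)

  inG-cofinite : ∀ x → bound ≤ x → inG x ≡ true
  inG-cofinite x bound≤x with parity x
  ... | inj₁ (y , refl) = GForm⇒inG (inj₁ (y , refl , large⇒InH y W≤y))
    where
    W≤y : W ≤ y
    W≤y = double-≤-cancel (≤-trans (m≤n+m (W + W) a) bound≤x)
  ... | inj₂ (y , refl) = GForm⇒inG (inj₂ (y ∸ K , odd-form-∸ K≤y , large⇒InH (y ∸ K) W≤y-K))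
    where
    K+W≤y : K + W ≤ y
    K+W≤y = double-≤-cancel (≤-pred (subst (_≤ suc (y + y)) (odd-form W) bound≤x))
    K≤y : K ≤ y
    K≤y = ≤-trans (m≤m+n K W) K+W≤y
    W≤y-K : W ≤ y ∸ K
    W≤y-K = subst (_≤ y ∸ K) (m+n∸m≡n K W) (∸-monoˡ-≤ K K+W≤y)

  InH-small : ∀ {m} → InH m → m < 2 + D → m ≡ 0 ⊎ m ≡ D
  InH-small (0 , 0 , refl , _ , _) _ = inj₁ refl
  InH-small (1 , 0 , refl , _ , _) _ = inj₂ (+-identityʳ D)
  InH-small (1 , 1 , _ , _ , inj₁ 1≢1) _ = contradiction refl 1≢1
  InH-small (1 , 1 , _ , _ , inj₂ (s≤s ())) _
  InH-small (1 , suc (suc t) , refl , _ , _) m<2+D =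
    contradiction m<2+D (≤⇒≯ (+-mono-≤ (m≤m+n 2 t) (≤-reflexive (sym (+-identityʳ D)))))
  InH-small (suc (suc M) , t , refl , _ , _) m<2+D =
    contradiction m<2+D
      (≤⇒≯ (≤-trans (+-monoˡ-≤ D 2≤D) (≤-trans (+-monoʳ-≤ D (m≤m+n D (M * D))) (m≤n+m _ t))))
    where
    2≤D : 2 ≤ D
    2≤D = s≤s (s≤s z≤n)

  G-small : ∀ {x} → G x → x < c → x ≡ 0 ⊎ x ≡ a ⊎ x ≡ b
  G-small x∈ x<c = from-form (G⇒GForm x∈) x<c
    where
    c+9+6n≡a+D+D : (24 + 12 * n) + (9 + 6 * n) ≡ (13 + 6 * n) + ((10 + 6 * n) + (10 + 6 * n))
    c+9+6n≡a+D+D = solve (n List.∷ List.[])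
    half<2+D : ∀ {m} → m + m < c → m < 2 + D
    half<2+D {m} 2m<c = double-<-cancel (subst (m + m <_) c≡[2+D]+[2+D] 2m<c)
    even : ∀ {m} → m ≡ 0 ⊎ m ≡ D → m + m ≡ 0 ⊎ m + m ≡ a ⊎ m + m ≡ b
    even (inj₁ refl) = inj₁ refl
    even (inj₂ refl) = inj₂ (inj₂ (sym b≡D+D))
    odd : ∀ {m} → a + (m + m) < c → m ≡ 0 ⊎ m ≡ D →
          a + (m + m) ≡ 0 ⊎ a + (m + m) ≡ a ⊎ a + (m + m) ≡ b
    odd _   (inj₁ refl) = inj₂ (inj₁ (+-identityʳ a))
    odd x<c (inj₂ refl) = contradiction x<c (≤⇒≯ (≤-witness (9 + 6 * n) c+9+6n≡a+D+D))
    from-form : ∀ {x} → GForm x → x < c → x ≡ 0 ⊎ x ≡ a ⊎ x ≡ b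
    from-form (inj₁ (m , refl , m∈)) x<c = even (InH-small m∈ (half<2+D x<c))
    from-form (inj₂ (m , refl , m∈)) x<c =
      odd x<c (InH-small m∈ (half<2+D (≤-trans (s≤s (m≤n+m (m + m) a)) x<c)))

-- The scan, block by block

module Blocks (n : ℕ) where
  open Semigroup n public
  open Enumeration inG bound inG-cofinite public

  -- Block M covers y = t + (M + 1)·D for t < D. At each block start the current triple holds a single
  -- element, of the residue of 2y + 1; as D ≡ 1 (mod 3), the next start has residue rotate (rotate p).
  boundary : Fin 3 → ScanState
  boundary p = p , ahead p

  AtBoundary : ℕ → Set
  AtBoundary y = ∃ λ p → snapshot y ≡ boundary p

  blockStart : ℕ → ℕ
  blockStart M = 9 + 6 * n + M * D

  blockStart-suc : ∀ M → blockStart M + D ≡ blockStart (suc M)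
  blockStart-suc M = trans (+-assoc (9 + 6 * n) (M * D) D) (cong (9 + 6 * n +_) (+-comm (M * D) D))

  in-block : ∀ M x → suc ((9 + 6 * n + M * (10 + 6 * n)) + x) ≡ x + suc M * (10 + 6 * n)
  in-block M x = solve (M List.∷ x List.∷ n List.∷ List.[])

  BlockGoal : ℕ → Set
  BlockGoal M = AtBoundary (blockStart M) →
                AtBoundary (blockStart (suc M)) × (∀ i → i ≤ D → Unbroken (snapshot (blockStart M + i)))

  block-from-runs : ∀ M rs → Spells (blockStart M) 0 rs → totalLength rs ≡ D →
                    (∀ p → runsSafe rs (boundary p) ≡ true) →
                    (∀ p → applyRuns rs (boundary p) ≡ boundary (rotate (rotate p))) → BlockGoal M
  block-from-runs M rs spelled length≡D safe ends (p , at-start) =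
    (rotate (rotate p) , at-end) , λ i i≤D → proj₂ runs i (subst (i ≤_) (sym length≡D) i≤D)
    where
    start≡ : snapshot (blockStart M + 0) ≡ boundary p
    start≡ = trans (cong snapshot (+-identityʳ (blockStart M))) at-start
    runs = runs-sound (blockStart M) 0 rs spelled (subst Unbroken (sym start≡) λ ())
             (subst (λ z → runsSafe rs z ≡ true) (sym start≡) (safe p))
    at-end : snapshot (blockStart (suc M)) ≡ boundary (rotate (rotate p))
    at-end = begin
      snapshot (blockStart (suc M))                  ≡⟨ cong snapshot (blockStart-suc M) ⟨
      snapshot (blockStart M + D)                    ≡⟨ cong (λ k → snapshot (blockStart M + k)) length≡D ⟨
      snapshot (blockStart M + (0 + totalLength rs)) ≡⟨ proj₁ runs ⟩
      applyRuns rs (snapshot (blockStart M + 0))   ≡⟨ cong (applyRuns rs) start≡ ⟩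
      applyRuns rs (boundary p)                    ≡⟨ ends p ⟩
      boundary (rotate (rotate p))                 ∎
      where open ≡-Reasoning

  D≡K+[4+3n] : 10 + 6 * n ≡ (6 + 3 * n) + (4 + 3 * n)
  D≡K+[4+3n] = solve (n List.∷ List.[])

  K≤D : K ≤ D
  K≤D = subst (K ≤_) (sym D≡K+[4+3n]) (m≤m+n K (4 + 3 * n))

  admissible-yes : ∀ M t → t ≤ 3 * M → t ≢ 1 → admissible M t ≡ true
  admissible-yes M t t≤3M t≢1 = dec-true (admissible? M t) (t≤3M , inj₁ t≢1)

  admissible-no : ∀ M t → 3 * M < t → admissible M t ≡ false
  admissible-no M t 3M<t = dec-false (admissible? M t) λ (t≤3M , _) → <⇒≱ 3M<t t≤3M

  admissible-one : ∀ M → M < L → admissible M 1 ≡ false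
  admissible-one M M<L = dec-false (admissible? M 1) λ
    { (_ , inj₁ 1≢1) → 1≢1 refl
    ; (_ , inj₂ L≤M) → <⇒≱ M<L L≤M }

  letter-low : ∀ {y A B} M t → y ≡ t + suc M * D → t < K →
               admissible (suc M) t ≡ A → admissible M (t + (4 + 3 * n)) ≡ B → letter y ≡ (A , B)
  letter-low {y} M t refl t<K even odd = cong₂ _,_
    (trans (inG-even y) (trans (inH-digits (suc M) t (≤-trans t<K K≤D)) even))
    (begin
      inG (suc (y + y))                         ≡⟨ inG-odd y ⟩
      does (K ≤? y) ∧ inH (y ∸ K)               ≡⟨ cong₂ _∧_ (dec-true (K ≤? y) K≤y) (cong inH y∸K≡) ⟩
      inH ((t + (4 + 3 * n)) + M * D)           ≡⟨ inH-digits M (t + (4 + 3 * n)) t+4+3n<D ⟩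
      admissible M (t + (4 + 3 * n))            ≡⟨ odd ⟩
      _                                         ∎)
    where
    open ≡-Reasoning
    K≤y : K ≤ y
    K≤y = ≤-trans K≤D (≤-trans (m≤m+n D (M * D)) (m≤n+m (D + M * D) t))
    shift-by-K : t + (10 + 6 * n + M * (10 + 6 * n)) ≡ ((t + (4 + 3 * n)) + M * (10 + 6 * n)) + (6 + 3 * n)
    shift-by-K = solve (t List.∷ M List.∷ n List.∷ List.[])
    y∸K≡ : y ∸ K ≡ (t + (4 + 3 * n)) + M * D
    y∸K≡ = trans (cong (_∸ K) shift-by-K) (m+n∸n≡m _ K)
    t+4+3n<D : t + (4 + 3 * n) < D
    t+4+3n<D = subst (t + (4 + 3 * n) <_) (sym D≡K+[4+3n]) (+-monoˡ-< (4 + 3 * n) t<K)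

  letter-high : ∀ {y A B} M u → y ≡ (K + u) + M * D → u < 4 + 3 * n →
                admissible M (K + u) ≡ A → admissible M u ≡ B → letter y ≡ (A , B)
  letter-high {y} M u refl u<4+3n even odd = cong₂ _,_
    (trans (inG-even y) (trans (inH-digits M (K + u) K+u<D) even))
    (begin
      inG (suc (y + y))                         ≡⟨ inG-odd y ⟩
      does (K ≤? y) ∧ inH (y ∸ K)               ≡⟨ cong₂ _∧_ (dec-true (K ≤? y) K≤y) (cong inH y∸K≡) ⟩
      inH (u + M * D)                           ≡⟨ inH-digits M u u<D ⟩
      admissible M u                            ≡⟨ odd ⟩
      _                                         ∎)
    where
    open ≡-Reasoning
    K≤y : K ≤ y
    K≤y = ≤-trans (m≤m+n K u) (m≤m+n (K + u) (M * D))
    y∸K≡ : y ∸ K ≡ u + M * D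
    y∸K≡ = trans (cong (_∸ K) (+-assoc K u (M * D))) (m+n∸m≡n K (u + M * D))
    K+u<D : K + u < D
    K+u<D = subst (K + u <_) (sym D≡K+[4+3n]) (+-monoʳ-< K u<4+3n)
    u<D : u < D
    u<D = ≤-trans u<4+3n (subst (4 + 3 * n ≤_) (sym D≡K+[4+3n]) (m≤n+m (4 + 3 * n) K))

  in-block-high : ∀ M x u → x ≡ K + u → suc (blockStart M + x) ≡ (K + u) + suc M * D
  in-block-high M x u x≡K+u = trans (in-block M x) (cong (_+ suc M * D) x≡K+u)

  letter-initial : ∀ {A} t → t < K → admissible 0 t ≡ A → letter t ≡ (A , false)
  letter-initial t t<K even = cong₂ _,_
    (trans (inG-even t) (trans (cong inH (sym (+-identityʳ t))) (trans (inH-digits 0 t (≤-trans t<K K≤D)) even)))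
    (trans (inG-odd t) (cong (_∧ inH (t ∸ K)) (dec-false (K ≤? t) (<⇒≱ t<K))))

  initial-runs : List Run
  initial-runs = repeat (false , false) 2 (suc n) ∷ once (false , true) ∷ repeat (false , false) 0 (suc n) ∷ []

  initial-spelled : Spells 0 0 initial-runs
  initial-spelled = run₁ , at-K , run₃ , tt
    where
    K≡ : 1 + (2 + 3 * suc n) ≡ 6 + 3 * n
    K≡ = solve (n List.∷ List.[])
    run₁ : ∀ i → i < 2 + 3 * suc n → letter (suc i) ≡ (false , false)
    run₁ i i< = letter-initial (suc i) (<-offset 1 i< K≡) (admissible-no 0 (suc i) (s≤s z≤n))
    at-K : letter (suc ((2 + 3 * suc n) + 0)) ≡ (false , true)
    at-K = letter-high 0 0 y≡K (s≤s z≤n) (admissible-no 0 (K + 0) (s≤s z≤n)) (admissible-yes 0 0 z≤n λ ())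
      where
      y≡K : suc ((2 + 3 * suc n) + 0) ≡ ((6 + 3 * n) + 0) + 0 * (10 + 6 * n)
      y≡K = solve (n List.∷ List.[])
    run₃ : ∀ i → i < 3 * suc n → letter (suc (((2 + 3 * suc n) + 1) + i)) ≡ (false , false)
    run₃ i i< = letter-high 0 (suc i) after-K (<-offset 1 i< 4+3n≡)
                  (admissible-no 0 (K + suc i) (s≤s z≤n)) (admissible-no 0 (suc i) (s≤s z≤n))
      where
      after-K : suc (((2 + 3 * suc n) + 1) + i) ≡ ((6 + 3 * n) + suc i) + 0 * (10 + 6 * n)
      after-K = solve (i List.∷ n List.∷ List.[])
      4+3n≡ : 1 + 3 * suc n ≡ 4 + 3 * n
      4+3n≡ = solve (n List.∷ List.[])

  initial-block : AtBoundary (blockStart 0) × (∀ i → i ≤ blockStart 0 → Unbroken (snapshot i))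
  initial-block = (1F , trans (cong snapshot (sym length≡)) (proj₁ runs)) ,
                  λ i i≤ → proj₂ runs i (subst (i ≤_) (sym length≡) i≤)
    where
    runs = runs-sound 0 0 initial-runs initial-spelled (λ ()) refl
    length≡ : (2 + 3 * suc n) + (1 + ((3 * suc n) + 0)) ≡ 9 + 6 * n + 0 * (10 + 6 * n)
    length≡ = solve (n List.∷ List.[])

module EarlyBlock (m q : ℕ) where
  open Blocks (m + q)

  private
    3m<4+3n : 3 * m < 4 + 3 * (m + q)
    3m<4+3n = s≤s (≤-trans (*-monoʳ-≤ 3 (m≤m+n m q)) (m≤n+m _ 3))
    3[m+1]<K : 3 * suc m < K
    3[m+1]<K = <-witness (2 + 3 * q) e
      where
      e : suc (3 * suc m + (2 + 3 * q)) ≡ 6 + 3 * (m + q)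
      e = solve (m List.∷ q List.∷ List.[])
    3[m+1]<4+3m : 3 * suc m < 4 + 3 * m
    3[m+1]<4+3m = <-witness 0 e
      where
      e : suc (3 * suc m + 0) ≡ 4 + 3 * m
      e = solve (m List.∷ List.[])
    m+1<L : suc m < L
    m+1<L = <-witness (3 + m + 2 * q) e
      where
      e : suc (suc m + (3 + m + 2 * q)) ≡ 5 + 2 * (m + q)
      e = solve (m List.∷ q List.∷ List.[])
    low-end : (4 + 3 * m) + (2 + 3 * q) ≡ 6 + 3 * (m + q)
    low-end = solve (m List.∷ q List.∷ List.[])
    high-end : (4 + 3 * m) + (3 * q) ≡ 4 + 3 * (m + q)
    high-end = solve (m List.∷ q List.∷ List.[])
    ≤3[m+1] : 2 + (2 + 3 * m) ≡ suc (3 * suc m)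
    ≤3[m+1] = solve (m List.∷ List.[])
    at-K : ((2 + (2 + 3 * m)) + (2 + 3 * q)) + 0 ≡ (6 + 3 * (m + q)) + 0
    at-K = solve (m List.∷ q List.∷ List.[])
    at-K+1 : (((2 + (2 + 3 * m)) + (2 + 3 * q)) + 1) + 0 ≡ (6 + 3 * (m + q)) + 1
    at-K+1 = solve (m List.∷ q List.∷ List.[])
    at-K+2 : ∀ i → ((((2 + (2 + 3 * m)) + (2 + 3 * q)) + 1) + 1) + i ≡ (6 + 3 * (m + q)) + (2 + i)
    at-K+2 i = solve (m List.∷ q List.∷ i List.∷ List.[])
    after-run₇ : ∀ i → (((((2 + (2 + 3 * m)) + (2 + 3 * q)) + 1) + 1) + (2 + 3 * m)) + i ≡
                        (6 + 3 * (m + q)) + ((4 + 3 * m) + i)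
    after-run₇ i = solve (m List.∷ q List.∷ i List.∷ List.[])
    length≡D : 1 + (1 + ((2 + 3 * m) + ((2 + 3 * q) + (1 + (1 + ((2 + 3 * m) + ((3 * q) + 0))))))) ≡ 10 + 6 * (m + q)
    length≡D = solve (m List.∷ q List.∷ List.[])

    odd-low : ∀ t → admissible m (t + (4 + 3 * (m + q))) ≡ false
    odd-low t = admissible-no m _ (≤-trans 3m<4+3n (m≤n+m _ t))

  runs : List Run
  runs = once (true , false) ∷ once (false , false) ∷ repeat (true , false) 2 m ∷ repeat (false , false) 2 q ∷
         once (false , true) ∷ once (false , false) ∷ repeat (false , true) 2 m ∷ repeat (false , false) 0 q ∷ []

  spelled : Spells (blockStart m) 0 runs
  spelled =
    letter-low m 0 (in-block m 0) (s≤s z≤n) (admissible-yes (suc m) 0 z≤n λ ()) (odd-low 0) ,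
    letter-low m 1 (in-block m 1) (s≤s (s≤s z≤n)) (admissible-one (suc m) m+1<L) (odd-low 1) ,
    run₃ , run₄ ,
    letter-high (suc m) 0 (in-block-high m _ 0 at-K) (s≤s z≤n)
      (admissible-no (suc m) _ (≤-trans 3[m+1]<K (m≤m+n K 0))) (admissible-yes (suc m) 0 z≤n λ ()) ,
    letter-high (suc m) 1 (in-block-high m _ 1 at-K+1) (s≤s (s≤s z≤n))
      (admissible-no (suc m) _ (≤-trans 3[m+1]<K (m≤m+n K 1))) (admissible-one (suc m) m+1<L) ,
    run₇ , run₈ , tt
    where
    run₃ : ∀ i → i < 2 + 3 * m → _
    run₃ i i< = letter-low m (2 + i) (in-block m (2 + i))
      (≤-trans (<-offset 2 i< refl) (≤-witness (2 + 3 * q) low-end))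
      (admissible-yes (suc m) (2 + i) (≤-offset 2 i< ≤3[m+1]) λ ()) (odd-low (2 + i))
    run₄ : ∀ i → i < 2 + 3 * q → _
    run₄ i i< = letter-low m ((4 + 3 * m) + i) (in-block m _) (<-offset (4 + 3 * m) i< low-end)
      (admissible-no (suc m) _ (≤-trans 3[m+1]<4+3m (m≤m+n _ i))) (odd-low ((4 + 3 * m) + i))
    run₇ : ∀ i → i < 2 + 3 * m → _
    run₇ i i< = letter-high (suc m) (2 + i) (in-block-high m _ (2 + i) (at-K+2 i))
      (≤-trans (<-offset 2 i< refl) (≤-witness (3 * q) high-end))
      (admissible-no (suc m) _ (≤-trans 3[m+1]<K (m≤m+n K (2 + i))))
      (admissible-yes (suc m) (2 + i) (≤-offset 2 i< ≤3[m+1]) λ ())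
    run₈ : ∀ i → i < 3 * q → _
    run₈ i i< = letter-high (suc m) ((4 + 3 * m) + i) (in-block-high m _ _ (after-run₇ i))
      (<-offset (4 + 3 * m) i< high-end)
      (admissible-no (suc m) _ (≤-trans 3[m+1]<K (m≤m+n K _)))
      (admissible-no (suc m) _ (≤-trans 3[m+1]<4+3m (m≤m+n _ i)))

  block : BlockGoal m
  block = block-from-runs m runs spelled length≡D
            (λ { 0F → refl ; 1F → refl ; 2F → refl }) (λ { 0F → refl ; 1F → refl ; 2F → refl })

module MiddleBlock (n : ℕ) where
  open Blocks n

  private
    M = suc (suc n)
    3[n+1]<4+3n : 3 * suc n < 4 + 3 * n
    3[n+1]<4+3n = <-witness 0 e
      where
      e : suc (3 * suc n + 0) ≡ 4 + 3 * n
      e = solve (n List.∷ List.[])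
    M<L : M < L
    M<L = <-witness (2 + n) e
      where
      e : suc (suc (suc n) + (2 + n)) ≡ 5 + 2 * n
      e = solve (n List.∷ List.[])
    K≡3M : 6 + 3 * n ≡ 3 * suc (suc n)
    K≡3M = solve (n List.∷ List.[])
    K+0≡3M : ((6 + 3 * n) + 0) + 0 ≡ 3 * suc (suc n)
    K+0≡3M = solve (n List.∷ List.[])
    low-end : 2 + (1 + 3 * suc n) ≡ 6 + 3 * n
    low-end = solve (n List.∷ List.[])
    at-K : (2 + (1 + 3 * suc n)) + 0 ≡ (6 + 3 * n) + 0
    at-K = solve (n List.∷ List.[])
    at-K+1 : ((2 + (1 + 3 * suc n)) + 1) + 0 ≡ (6 + 3 * n) + 1
    at-K+1 = solve (n List.∷ List.[])
    at-K+2 : ∀ i → (((2 + (1 + 3 * suc n)) + 1) + 1) + i ≡ (6 + 3 * n) + (2 + i)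
    at-K+2 i = solve (n List.∷ i List.∷ List.[])
    3M<K+1 : suc (3 * suc (suc n) + 0) ≡ (6 + 3 * n) + 1
    3M<K+1 = solve (n List.∷ List.[])
    3M<K+2+i : ∀ i → suc (3 * suc (suc n) + (1 + i)) ≡ (6 + 3 * n) + (2 + i)
    3M<K+2+i i = solve (n List.∷ i List.∷ List.[])
    4+3n<3M : (4 + 3 * n) + 2 ≡ 3 * suc (suc n)
    4+3n<3M = solve (n List.∷ List.[])
    length≡D : 1 + (1 + ((1 + 3 * suc n) + (1 + (1 + ((2 + 3 * n) + 0))))) ≡ 10 + 6 * n
    length≡D = solve (n List.∷ List.[])

    odd-low : ∀ t → admissible (suc n) (t + (4 + 3 * n)) ≡ false
    odd-low t = admissible-no (suc n) _ (≤-trans 3[n+1]<4+3n (m≤n+m _ t))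

  runs : List Run
  runs = once (true , false) ∷ once (false , false) ∷ repeat (true , false) 1 (suc n) ∷
         once (true , true) ∷ once (false , false) ∷ repeat (false , true) 2 n ∷ []

  spelled : Spells (blockStart (suc n)) 0 runs
  spelled =
    letter-low (suc n) 0 (in-block (suc n) 0) (s≤s z≤n) (admissible-yes M 0 z≤n λ ()) (odd-low 0) ,
    letter-low (suc n) 1 (in-block (suc n) 1) (s≤s (s≤s z≤n)) (admissible-one M M<L) (odd-low 1) ,
    run₃ ,
    letter-high M 0 (in-block-high (suc n) _ 0 at-K) (s≤s z≤n)
      (admissible-yes M _ (≤-witness 0 K+0≡3M) λ ()) (admissible-yes M 0 z≤n λ ()) ,
    letter-high M 1 (in-block-high (suc n) _ 1 at-K+1) (s≤s (s≤s z≤n))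
      (admissible-no M _ (<-witness 0 3M<K+1)) (admissible-one M M<L) ,
    run₆ , tt
    where
    run₃ : ∀ i → i < 1 + 3 * suc n → _
    run₃ i i< = letter-low (suc n) (2 + i) (in-block (suc n) (2 + i)) 2+i<K
      (admissible-yes M (2 + i) (subst (2 + i ≤_) K≡3M (<⇒≤ 2+i<K)) λ ()) (odd-low (2 + i))
      where
      2+i<K : 2 + i < K
      2+i<K = <-offset 2 i< low-end
    run₆ : ∀ i → i < 2 + 3 * n → _
    run₆ i i< = letter-high M (2 + i) (in-block-high (suc n) _ (2 + i) (at-K+2 i)) 2+i<4+3n
      (admissible-no M _ (<-witness (1 + i) (3M<K+2+i i)))
      (admissible-yes M (2 + i) (≤-trans (<⇒≤ 2+i<4+3n) (≤-witness 2 4+3n<3M)) λ ())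
      where
      2+i<4+3n : 2 + i < 4 + 3 * n
      2+i<4+3n = <-offset 2 i< refl

  block : BlockGoal (suc n)
  block = block-from-runs (suc n) runs spelled length≡D
            (λ { 0F → refl ; 1F → refl ; 2F → refl }) (λ { 0F → refl ; 1F → refl ; 2F → refl })

module LateBlock (p q : ℕ) where
  open Blocks (p + q)

  private
    M′ M : ℕ
    M′ = suc (suc ((p + q) + p))
    M  = suc M′

    odd-low-bound : ((2 + 3 * p) + (4 + 3 * (p + q))) + 0 ≡ 3 * suc (suc ((p + q) + p))
    odd-low-bound = solve (p List.∷ q List.∷ List.[])
    odd-low-gap : suc (3 * suc (suc ((p + q) + p)) + 0) ≡ (3 + 3 * p) + (4 + 3 * (p + q))
    odd-low-gap = solve (p List.∷ q List.∷ List.[])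
    M<L : M < L
    M<L = <-witness (1 + q) e
      where
      e : suc (suc (suc (suc ((p + q) + p))) + (1 + q)) ≡ 5 + 2 * (p + q)
      e = solve (p List.∷ q List.∷ List.[])
    K+3+3p≡3M : ((6 + 3 * (p + q)) + 0) + (3 + 3 * p) ≡ 3 * suc (suc (suc ((p + q) + p)))
    K+3+3p≡3M = solve (p List.∷ q List.∷ List.[])
    K+1+2+3p≡3M : ((6 + 3 * (p + q)) + 1) + (2 + 3 * p) ≡ 3 * suc (suc (suc ((p + q) + p)))
    K+1+2+3p≡3M = solve (p List.∷ q List.∷ List.[])
    K+4+3p≡3M+1 : (6 + 3 * (p + q)) + (4 + 3 * p) ≡ suc (3 * suc (suc (suc ((p + q) + p))))
    K+4+3p≡3M+1 = solve (p List.∷ q List.∷ List.[])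
    3M<K+4+3p+i : ∀ i → suc (3 * suc (suc (suc ((p + q) + p))) + i) ≡ (6 + 3 * (p + q)) + ((4 + 3 * p) + i)
    3M<K+4+3p+i i = solve (p List.∷ q List.∷ i List.∷ List.[])
    4+3n≤3M : (4 + 3 * (p + q)) + (5 + 3 * p) ≡ 3 * suc (suc (suc ((p + q) + p)))
    4+3n≤3M = solve (p List.∷ q List.∷ List.[])
    3+3p≤3M : (3 + 3 * p) + (6 + 3 * (p + q)) ≡ 3 * suc (suc (suc ((p + q) + p)))
    3+3p≤3M = solve (p List.∷ q List.∷ List.[])
    3+3p≤K : (3 + 3 * p) + (3 + 3 * q) ≡ 6 + 3 * (p + q)
    3+3p≤K = solve (p List.∷ q List.∷ List.[])
    low-end : (2 + (1 + 3 * p)) + 3 * suc q ≡ 6 + 3 * (p + q)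
    low-end = solve (p List.∷ q List.∷ List.[])
    high-end : (4 + 3 * p) + (3 * q) ≡ 4 + 3 * (p + q)
    high-end = solve (p List.∷ q List.∷ List.[])
    at-K : ((2 + (1 + 3 * p)) + 3 * suc q) + 0 ≡ (6 + 3 * (p + q)) + 0
    at-K = solve (p List.∷ q List.∷ List.[])
    at-K+1 : (((2 + (1 + 3 * p)) + 3 * suc q) + 1) + 0 ≡ (6 + 3 * (p + q)) + 1
    at-K+1 = solve (p List.∷ q List.∷ List.[])
    at-K+2 : ∀ i → ((((2 + (1 + 3 * p)) + 3 * suc q) + 1) + 1) + i ≡ (6 + 3 * (p + q)) + (2 + i)
    at-K+2 i = solve (p List.∷ q List.∷ i List.∷ List.[])
    after-run₇ : ∀ i → (((((2 + (1 + 3 * p)) + 3 * suc q) + 1) + 1) + (2 + 3 * p)) + i ≡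
                        (6 + 3 * (p + q)) + ((4 + 3 * p) + i)
    after-run₇ i = solve (p List.∷ q List.∷ i List.∷ List.[])
    length≡D : 1 + (1 + ((1 + 3 * p) + ((3 * suc q) + (1 + (1 + ((2 + 3 * p) + ((3 * q) + 0))))))) ≡ 10 + 6 * (p + q)
    length≡D = solve (p List.∷ q List.∷ List.[])

    K≤3M : K ≤ 3 * M
    K≤3M = ≤-witness (3 + 3 * p) (trans (cong (_+ (3 + 3 * p)) (sym (+-identityʳ K))) K+3+3p≡3M)
    4+3n≤3M′ : 4 + 3 * (p + q) ≤ 3 * M
    4+3n≤3M′ = ≤-witness (5 + 3 * p) 4+3n≤3M

    odd-low-yes : ∀ t → t ≤ 2 + 3 * p → admissible M′ (t + (4 + 3 * (p + q))) ≡ true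
    odd-low-yes t t≤ =
      admissible-yes M′ _ (≤-trans (+-monoˡ-≤ (4 + 3 * (p + q)) t≤) (≤-witness 0 odd-low-bound))
                         (2≤⇒≢1 (≤-trans (s≤s (s≤s z≤n)) (m≤n+m (4 + 3 * (p + q)) t)))
    odd-low-no : ∀ t → 3 + 3 * p ≤ t → admissible M′ (t + (4 + 3 * (p + q))) ≡ false
    odd-low-no t ≤t = admissible-no M′ _ (≤-trans (<-witness 0 odd-low-gap) (+-monoˡ-≤ (4 + 3 * (p + q)) ≤t))

  runs : List Run
  runs = once (true , true) ∷ once (false , true) ∷ repeat (true , true) 1 p ∷ repeat (true , false) 0 (suc q) ∷
         once (true , true) ∷ once (true , false) ∷ repeat (true , true) 2 p ∷ repeat (false , true) 0 q ∷ []

  spelled : Spells (blockStart M′) 0 runs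
  spelled =
    letter-low M′ 0 (in-block M′ 0) (s≤s z≤n) (admissible-yes M 0 z≤n λ ()) (odd-low-yes 0 z≤n) ,
    letter-low M′ 1 (in-block M′ 1) (s≤s (s≤s z≤n)) (admissible-one M M<L) (odd-low-yes 1 (s≤s z≤n)) ,
    run₃ , run₄ ,
    letter-high M 0 (in-block-high M′ _ 0 at-K) (s≤s z≤n)
      (admissible-yes M (K + 0) (≤-witness (3 + 3 * p) K+3+3p≡3M) λ ())
      (admissible-yes M 0 z≤n λ ()) ,
    letter-high M 1 (in-block-high M′ _ 1 at-K+1) (s≤s (s≤s z≤n))
      (admissible-yes M (K + 1) (≤-witness (2 + 3 * p) K+1+2+3p≡3M) λ ())
      (admissible-one M M<L) ,
    run₇ , run₈ , tt
    where
    run₃ : ∀ i → i < 1 + 3 * p → _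
    run₃ i i< = letter-low M′ (2 + i) (in-block M′ (2 + i)) (≤-trans 2+i<3+3p (≤-witness (3 + 3 * q) 3+3p≤K))
      (admissible-yes M (2 + i) (<⇒≤ (≤-trans 2+i<3+3p (≤-witness (6 + 3 * (p + q)) 3+3p≤3M))) λ ())
      (odd-low-yes (2 + i) (≤-offset 2 i< refl))
      where
      2+i<3+3p : 2 + i < 3 + 3 * p
      2+i<3+3p = <-offset 2 i< refl
    run₄ : ∀ i → i < 3 * suc q → _
    run₄ i i< = letter-low M′ ((2 + (1 + 3 * p)) + i) (in-block M′ _) t<K
      (admissible-yes M ((3 + 3 * p) + i) (≤-trans (<⇒≤ t<K) K≤3M) λ ())
      (odd-low-no _ (m≤m+n (3 + 3 * p) i))
      where
      t<K : (2 + (1 + 3 * p)) + i < K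
      t<K = <-offset (2 + (1 + 3 * p)) i< low-end
    run₇ : ∀ i → i < 2 + 3 * p → _
    run₇ i i< = letter-high M (2 + i) (in-block-high M′ _ (2 + i) (at-K+2 i)) u<
      (admissible-yes M (K + (2 + i))
         (≤-pred (subst (K + (2 + i) <_) K+4+3p≡3M+1 (+-monoʳ-< K (<-offset 2 i< refl))))
         λ ())
      (admissible-yes M (2 + i) (<⇒≤ (≤-trans u< 4+3n≤3M′)) λ ())
      where
      u< : 2 + i < 4 + 3 * (p + q)
      u< = ≤-trans (<-offset 2 i< refl) (≤-witness (3 * q) high-end)
    run₈ : ∀ i → i < 3 * q → _
    run₈ i i< = letter-high M ((4 + 3 * p) + i) (in-block-high M′ _ _ (after-run₇ i)) u<
      (admissible-no M _ (<-witness i (3M<K+4+3p+i i)))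
      (admissible-yes M ((4 + 3 * p) + i) (<⇒≤ (≤-trans u< 4+3n≤3M′)) λ ())
      where
      u< : (4 + 3 * p) + i < 4 + 3 * (p + q)
      u< = <-offset (4 + 3 * p) i< high-end

  block : BlockGoal M′
  block = block-from-runs M′ runs spelled length≡D
            (λ { 0F → refl ; 1F → refl ; 2F → refl }) (λ { 0F → refl ; 1F → refl ; 2F → refl })

module FinalStretch (n : ℕ) where
  open Blocks n

  private
    M′ M : ℕ
    M′ = suc (suc (suc (n + n)))
    M  = suc M′

    odd-low-bound : ((5 + 3 * n) + (4 + 3 * n)) + 0 ≡ 3 * suc (suc (suc (n + n)))
    odd-low-bound = solve (n List.∷ List.[])
    M<L : M < L
    M<L = <-witness 0 e
      where
      e : suc (suc (suc (suc (suc (n + n)))) + 0) ≡ 5 + 2 * n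
      e = solve (n List.∷ List.[])
    K+K≡3M : (6 + 3 * n) + (6 + 3 * n) ≡ 3 * suc (suc (suc (suc (n + n))))
    K+K≡3M = solve (n List.∷ List.[])
    K+0+K≡3M : ((6 + 3 * n) + 0) + (6 + 3 * n) ≡ 3 * suc (suc (suc (suc (n + n))))
    K+0+K≡3M = solve (n List.∷ List.[])
    K+1+5+3n≡3M : ((6 + 3 * n) + 1) + (5 + 3 * n) ≡ 3 * suc (suc (suc (suc (n + n))))
    K+1+5+3n≡3M = solve (n List.∷ List.[])
    low-end : 2 + (1 + 3 * suc n) ≡ 6 + 3 * n
    low-end = solve (n List.∷ List.[])
    at-K : (2 + (1 + 3 * suc n)) + 0 ≡ (6 + 3 * n) + 0
    at-K = solve (n List.∷ List.[])
    at-K+1 : ((2 + (1 + 3 * suc n)) + 1) + 0 ≡ (6 + 3 * n) + 1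
    at-K+1 = solve (n List.∷ List.[])
    beyond : ∀ i → suc ((9 + 6 * n + suc (suc (suc (n + n))) * (10 + 6 * n)) +
                         (1 + (1 + ((1 + 3 * suc n) + (1 + (1 + 0))))) + i)
                   ≡ ((6 + 3 * n) + ((4 + 2 * n) * (10 + 6 * n) + 2)) + i
    beyond i = solve (n List.∷ i List.∷ List.[])

    odd-low-yes : ∀ t → t ≤ 5 + 3 * n → admissible M′ (t + (4 + 3 * n)) ≡ true
    odd-low-yes t t≤ = admissible-yes M′ _ (≤-trans (+-monoˡ-≤ (4 + 3 * n) t≤) (≤-witness 0 odd-low-bound))
                         (2≤⇒≢1 (≤-trans (s≤s (s≤s z≤n)) (m≤n+m (4 + 3 * n) t)))

  runs : List Run
  runs = once (true , true) ∷ once (false , true) ∷ repeat (true , true) 1 (suc n) ∷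
         once (true , true) ∷ once (true , false) ∷ []

  spelled : Spells (blockStart M′) 0 runs
  spelled =
    letter-low M′ 0 (in-block M′ 0) (s≤s z≤n) (admissible-yes M 0 z≤n λ ()) (odd-low-yes 0 z≤n) ,
    letter-low M′ 1 (in-block M′ 1) (s≤s (s≤s z≤n)) (admissible-one M M<L) (odd-low-yes 1 (s≤s z≤n)) ,
    run₃ ,
    letter-high M 0 (in-block-high M′ _ 0 at-K) (s≤s z≤n)
      (admissible-yes M (K + 0) (≤-witness (6 + 3 * n) K+0+K≡3M) λ ())
      (admissible-yes M 0 z≤n λ ()) ,
    letter-high M 1 (in-block-high M′ _ 1 at-K+1) (s≤s (s≤s z≤n))
      (admissible-yes M (K + 1) (≤-witness (5 + 3 * n) K+1+5+3n≡3M) λ ())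
      (admissible-one M M<L) ,
    tt
    where
    run₃ : ∀ i → i < 1 + 3 * suc n → _
    run₃ i i< = letter-low M′ (2 + i) (in-block M′ (2 + i)) 2+i<K
      (admissible-yes M (2 + i) (≤-trans (<⇒≤ 2+i<K) (≤-witness (6 + 3 * n) K+K≡3M)) λ ())
      (odd-low-yes (2 + i) (≤-pred 2+i<K))
      where
      2+i<K : 2 + i < K
      2+i<K = <-offset 2 i< low-end

  letter-large : ∀ y → K + W ≤ y → letter y ≡ (true , true)
  letter-large y K+W≤y = cong₂ _,_
    (trans (inG-even y) (InH⇒inH (large⇒InH y (≤-trans (m≤n+m W K) K+W≤y))))
    (trans (inG-odd y) (cong₂ _∧_ (dec-true (K ≤? y) (≤-trans (m≤m+n K W) K+W≤y))
       (InH⇒inH (large⇒InH (y ∸ K) (subst (_≤ y ∸ K) (m+n∸m≡n K W) (∸-monoˡ-≤ K K+W≤y))))))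

  unbroken-beyond : AtBoundary (blockStart M′) → ∀ i → Unbroken (snapshot (blockStart M′ + i))
  unbroken-beyond (p , at-start) = within
    where
    y₀ = blockStart M′
    y₁ = y₀ + totalLength runs
    start≡ : snapshot (y₀ + 0) ≡ boundary p
    start≡ = trans (cong snapshot (+-identityʳ y₀)) at-start
    safe : ∀ p → runsSafe runs (boundary p) ≡ true
    safe = λ { 0F → refl ; 1F → refl ; 2F → refl }
    settles : ∀ p → Cycles (true , true) (applyRuns runs (boundary p)) ≡ true
    settles = λ { 0F → refl ; 1F → refl ; 2F → refl }
    prefix = runs-sound y₀ 0 runs spelled (subst Unbroken (sym start≡) λ ())
               (subst (λ z → runsSafe runs z ≡ true) (sym start≡) (safe p))
    tail-letters : ∀ j → letter (suc (y₁ + j)) ≡ (true , true)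
    tail-letters j = letter-large _ (≤-trans (m≤m+n (K + W) j) (≤-reflexive (sym (beyond j))))
    tail : ∀ j → Unbroken (snapshot (y₁ + j))
    tail = constant-forever {y₁} {true , true} tail-letters
             (subst (λ z → Cycles (true , true) z ≡ true)
                    (sym (trans (proj₁ prefix) (cong (applyRuns runs) start≡))) (settles p))
    within : ∀ i → Unbroken (snapshot (y₀ + i))
    within i with i ≤? totalLength runs
    ... | yes i≤ = proj₂ prefix i i≤
    ... | no  i≰ with d , len+d≡i ← m≤n⇒∃[o]m+o≡n (<⇒≤ (≰⇒> i≰)) =
      subst (Unbroken ∘ snapshot) (trans (+-assoc y₀ (totalLength runs) d) (cong (y₀ +_) len+d≡i)) (tail d)

module Theorem (n : ℕ) where
  open Blocks n

  lastBlock : ℕ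
  lastBlock = suc (suc (suc (n + n)))

  block : ∀ M → M < lastBlock → BlockGoal M
  block M M<last with M ≤? n
  ... | yes M≤n = subst (λ k → Blocks.BlockGoal k M) (m+[n∸m]≡n M≤n) (EarlyBlock.block M (n ∸ M))
  ... | no  M≰n with M ≟ℕ suc n
  ...   | yes refl = MiddleBlock.block n
  ...   | no  M≢n+1 =
    subst (Blocks.BlockGoal n) M≡
      (subst (λ k → Blocks.BlockGoal k (suc (suc (k + p)))) p+q≡n (LateBlock.block p q))
    where
    n+2≤M : suc (suc n) ≤ M
    n+2≤M = ≤∧≢⇒< (≰⇒> M≰n) (M≢n+1 ∘ sym)
    p = M ∸ suc (suc n)
    M≡ : suc (suc (n + p)) ≡ M
    M≡ = m+[n∸m]≡n n+2≤M
    p≤n : p ≤ n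
    p≤n = +-cancelˡ-≤ n p n (≤-pred (≤-pred (≤-pred (subst (_< lastBlock) (sym M≡) M<last))))
    q = n ∸ p
    p+q≡n : p + q ≡ n
    p+q≡n = m+[n∸m]≡n p≤n

  boundary-at : ∀ M → M ≤ lastBlock → AtBoundary (blockStart M)
  boundary-at zero    _      = proj₁ initial-block
  boundary-at (suc M) M<last = proj₁ (block M M<last (boundary-at M (≤-trans (n≤1+n M) M<last)))

  unbroken-until : ∀ M → M ≤ lastBlock → ∀ y → y ≤ blockStart M → Unbroken (snapshot y)
  unbroken-until zero    _      = proj₂ initial-block
  unbroken-until (suc M) M<last y y≤ with y ≤? blockStart M
  ... | yes y≤start = unbroken-until M (≤-trans (n≤1+n M) M<last) y y≤start
  ... | no  y≰start = within-block (m≤n⇒∃[o]m+o≡n (<⇒≤ (≰⇒> y≰start)))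
    where
    within-block : (∃ λ i → blockStart M + i ≡ y) → Unbroken (snapshot y)
    within-block (i , start+i≡y) = subst (Unbroken ∘ snapshot) start+i≡y
      (proj₂ (block M M<last (boundary-at M (≤-trans (n≤1+n M) M<last))) i
        (+-cancelˡ-≤ (blockStart M) i D (subst₂ _≤_ (sym start+i≡y) (sym (blockStart-suc M)) y≤)))

  unbroken-everywhere : ∀ y → Unbroken (snapshot y)
  unbroken-everywhere y with y ≤? blockStart lastBlock
  ... | yes y≤ = unbroken-until lastBlock ≤-refl y y≤
  ... | no  y≰ = beyond (m≤n⇒∃[o]m+o≡n (<⇒≤ (≰⇒> y≰)))
    where
    beyond : (∃ λ i → blockStart lastBlock + i ≡ y) → Unbroken (snapshot y)
    beyond (i , last+i≡y) =
      subst (Unbroken ∘ snapshot) last+i≡y (FinalStretch.unbroken-beyond n (boundary-at lastBlock ≤-refl) i)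

  next-below-c : ∀ {x y} → x < y → y ≤ c → G y →
                 (∀ w → w ≡ 0 ⊎ w ≡ a ⊎ w ≡ b → w ≤ x ⊎ y ≤ w) → next x ≡ y
  next-below-c {x} {y} x<y y≤c y∈ outside = next-unique record
    { is-member = proj₁ (G⇔inG y) y∈
    ; from≤     = x<y
    ; skipped   = λ z x<z z<y → ¬-not λ z∈ →
                    excluded z x<z z<y (G-small (proj₂ (G⇔inG z) z∈) (≤-trans z<y y≤c)) }
    where
    excluded : ∀ z → x < z → z < y → ¬ (z ≡ 0 ⊎ z ≡ a ⊎ z ≡ b)
    excluded z x<z z<y special with outside z special
    ... | inj₁ z≤x = <⇒≱ x<z z≤x
    ... | inj₂ y≤z = <⇒≱ z<y y≤z

  a<b : a < b
  a<b = <-witness (6 + 6 * n) e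
    where
    e : suc ((13 + 6 * n) + (6 + 6 * n)) ≡ 20 + 12 * n
    e = solve (n List.∷ List.[])

  b<c : b < c
  b<c = <-witness 3 e
    where
    e : suc ((20 + 12 * n) + 3) ≡ 24 + 12 * n
    e = solve (n List.∷ List.[])

  enum-1 : enum 1 ≡ a
  enum-1 = next-below-c (s≤s z≤n) (<⇒≤ (<-trans a<b b<c)) (gen-add gen-zero 0F) outside
    where
    outside : ∀ w → w ≡ 0 ⊎ w ≡ a ⊎ w ≡ b → w ≤ 0 ⊎ a ≤ w
    outside _ (inj₁ refl)        = inj₁ z≤n
    outside _ (inj₂ (inj₁ refl)) = inj₂ ≤-refl
    outside _ (inj₂ (inj₂ refl)) = inj₂ (<⇒≤ a<b)

  enum-2 : enum 2 ≡ b
  enum-2 = trans (cong next enum-1) (next-below-c a<b (<⇒≤ b<c) (gen-add gen-zero 1F) outside)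
    where
    outside : ∀ w → w ≡ 0 ⊎ w ≡ a ⊎ w ≡ b → w ≤ a ⊎ b ≤ w
    outside _ (inj₁ refl)        = inj₁ z≤n
    outside _ (inj₂ (inj₁ refl)) = inj₁ ≤-refl
    outside _ (inj₂ (inj₂ refl)) = inj₂ ≤-refl

  enum-3 : enum 3 ≡ c
  enum-3 = trans (cong next enum-2) (next-below-c b<c ≤-refl (gen-add gen-zero 2F) outside)
    where
    outside : ∀ w → w ≡ 0 ⊎ w ≡ a ⊎ w ≡ b → w ≤ b ⊎ c ≤ w
    outside _ (inj₁ refl)        = inj₁ z≤n
    outside _ (inj₂ (inj₁ refl)) = inj₁ (<⇒≤ a<b)
    outside _ (inj₂ (inj₂ refl)) = inj₁ ≤-refl

  generator≡enum : ∀ j → generator j ≡ enum (suc (toℕ j))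
  generator≡enum 0F = sym enum-1
  generator≡enum 1F = sym enum-2
  generator≡enum 2F = sym enum-3

  is-permutation : IsPermutationNS 3 G
  is-permutation = record
    { numerical = record
      { has-zero = gen-zero
      ; closed-+ = ⟨⟩-closed
      ; cofinite = bound , λ x bound≤x → proj₂ (G⇔inG x) (inG-cofinite x bound≤x) }
    ; g         = enum
    ; enum      = record
      { strictly-increasing = enum-increasing
      ; elements            = λ i → proj₂ (G⇔inG (enum i)) (enum-member (proj₁ (G⇔inG 0) gen-zero) i)
      ; exhaustive          = λ x x∈ → enum-surjective x (proj₁ (G⇔inG x) x∈) }
    ; generated = λ x → ⟨⟩-cong generator≡enum , ⟨⟩-cong (sym ∘ generator≡enum)
    ; residues  = residues-permuted (snapshots-unbroken unbroken-everywhere)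
    }

lemma4p5 : ∀ (k : ℕ) → 2 ≤ k →
    IsPermutationNS 3 ⟨ lookup (6 * k + 1 ∷ 12 * k ∸ 4 ∷ 12 * k ∷ []) ⟩
lemma4p5 zero ()
lemma4p5 (suc zero) (s≤s ())
lemma4p5 (suc (suc n)) _ = subst (λ v → IsPermutationNS 3 ⟨ lookup v ⟩) generators≡ (Theorem.is-permutation n)
  where
  a≡ : 13 + 6 * n ≡ 6 * suc (suc n) + 1
  a≡ = solve (n List.∷ List.[])
  c≡ : 24 + 12 * n ≡ 12 * suc (suc n)
  c≡ = solve (n List.∷ List.[])
  generators≡ : (13 + 6 * n ∷ 20 + 12 * n ∷ 24 + 12 * n ∷ []) ≡
                (6 * suc (suc n) + 1 ∷ 12 * suc (suc n) ∸ 4 ∷ 12 * suc (suc n) ∷ [])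
  generators≡ = cong₂ _∷_ a≡ (cong₂ _∷_ (cong (_∸ 4) c≡) (cong₂ _∷_ c≡ refl))
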